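{- Let $G$ be a graph of girth at least $6$ with exactly one vertex $x$ of type $2$ and no vertices of type $k$ for any $k\geq 3$. Then $G$ is almost well-covered if and only if all of the following hold: every internal vertex of $G$ other than $x$ is of type $0$ or $1$; $N(x)\cap V(G_0)=\emptyset$; $G_0$ is well-covered; and for every independent set $I$ in $G_1$: (a) if $I\cap N(x)=\emptyset$ then $\alpha(G_0)=i(G_0-N(I))$, and (b) if $I\cap N(x)\neq\emptyset$ then $\alpha(G_0)-i(G_0-N(I))\leq 1$.
   Context: All graphs are finite and simple; a graph with no cycles has infinite girth; the null graph (no vertices) is allowed. For a graph $G$, $\alpha(G)$ is the maximum size of an independent set and $i(G)$ is the minimum size of an inclusion-maximal independent set (both $0$ for the null graph). The independence gap is $\mu_\alpha(G)=\alpha(G)-i(G)$; $G$ is well-covered if $\mu_\alpha(G)=0$ and almost well-covered if $\mu_\alpha(G)=1$. $N(v)$ and $N(I)=\bigcup_{v\in I}N(v)$ denote open neighborhoods in $G$; $G_0-N(I)$ is obtained from $G_0$ by deleting the vertices of $N(I)$. Types: let $U$ be the set of vertices whose connected component in $G$ is a complete graph. In $G-U$, a leaf is a vertex of degree $1$ and an internal vertex is a vertex that is not a leaf. An internal vertex of $G-U$ adjacent to exactly $k$ leaves is of type $k$; every vertex of $U$ is of type $0$; leaves of $G-U$ have no type. $G_i$ denotes the subgraph of $G$ induced by all vertices of type $i$. -}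

module Defs where

open import Data.Nat using (ℕ; zero; suc; _⊔_; _⊓_; _≤_)
open import Data.Bool using (Bool; true; false; _∧_; _∨_; not; if_then_else_)
open import Data.Fin using (Fin; toℕ) renaming (_≟_ to _≟F_)
open import Data.Fin.Subset using (Subset; inside; outside; ∣_∣)
open import Data.Vec using (Vec; []; _∷_; lookup; tabulate)
open import Data.List using (List; []; _∷_; [_]; map; _++_; filterᵇ; length; foldr)
open import Data.Bool.ListAction using (all; any)
open import Data.List.Base using (allFin)
open import Data.Product using (_×_)
open import Data.Sum using (_⊎_)
open import Function using (Injective)
open import Relation.Binary.PropositionalEquality using (_≡_; _≢_)
open import Relation.Nullary using (¬_)
open import Relation.Nullary.Decidable using (⌊_⌋)

record Graph : Set where
  field
    n      : ℕ
    adj    : Fin n → Fin n → Bool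
    sym    : ∀ u v → adj u v ≡ adj v u
    irrefl : ∀ v → adj v v ≡ false
open Graph public

Vtx : Graph → Set
Vtx G = Fin (n G)

Adj : (G : Graph) → Vtx G → Vtx G → Set
Adj G u v = adj G u v ≡ true

-- Girth at least 6: there is no cycle of length 3, 4 or 5.
-- A cycle of length k is an injective map c : Fin k → V with c i ~ c (i+1 mod k).

CyclicSucc : {k : ℕ} → Fin k → Fin k → Set
CyclicSucc {k} i j = (suc (toℕ i) ≡ toℕ j) ⊎ ((suc (toℕ i) ≡ k) × (toℕ j ≡ 0))

IsCycle : (G : Graph) (k : ℕ) → (Fin k → Vtx G) → Set
IsCycle G k c = Injective _≡_ _≡_ c × (∀ i j → CyclicSucc i j → Adj G (c i) (c j))

GirthAtLeast6 : Graph → Set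
GirthAtLeast6 G = ∀ k → 3 ≤ k → k ≤ 5 → (c : Fin k → Vtx G) → ¬ IsCycle G k c

module _ (G : Graph) where

  verts : List (Vtx G)
  verts = allFin (n G)

  mem : Subset (n G) → Vtx G → Bool
  mem S v = lookup S v

  eqB : Vtx G → Vtx G → Bool
  eqB u v = ⌊ u ≟F v ⌋

  countB : (Vtx G → Bool) → ℕ
  countB p = length (filterᵇ p verts)

  inNbhB : Subset (n G) → Vtx G → Bool
  inNbhB I v = any (λ u → mem I u ∧ adj G u v) verts

  -- Connectivity: reach k u v  iff there is a walk of length ≤ k from u to v.
  -- u and v are in the same component iff reach (n G) u v (paths have < n edges).

  reach : ℕ → Vtx G → Vtx G → Bool
  reach zero    u v = eqB u v
  reach (suc k) u v = reach k u v ∨ any (λ w → reach k u w ∧ adj G w v) verts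

  sameComp : Vtx G → Vtx G → Bool
  sameComp u v = reach (n G) u v

  -- v ∈ U : the connected component of v is a complete graph
  inU : Vtx G → Bool
  inU v = all (λ u → all (λ w →
            not (sameComp v u ∧ sameComp v w ∧ not (eqB u w)) ∨ adj G u w) verts) verts

  degGU : Vtx G → ℕ
  degGU v = countB (λ w → adj G v w ∧ not (inU w))

  isOne : ℕ → Bool
  isOne k = ⌊ Data.Nat._≟_ k 1 ⌋

  leaf : Vtx G → Bool
  leaf v = not (inU v) ∧ isOne (degGU v)

  internal : Vtx G → Bool
  internal v = not (inU v) ∧ not (isOne (degGU v))

  leafNbrs : Vtx G → ℕ
  leafNbrs v = countB (λ w → adj G v w ∧ leaf w)

  hasType : ℕ → Vtx G → Bool
  hasType k v = (internal v ∧ ⌊ Data.Nat._≟_ (leafNbrs v) k ⌋)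
              ∨ (inU v ∧ ⌊ Data.Nat._≟_ k 0 ⌋)

  -- V(G_k): the vertex set of G_k (G_k is the subgraph induced by it)
  V : ℕ → Subset (n G)
  V k = tabulate (hasType k)

  allV : Subset (n G)
  allV = tabulate (λ _ → true)

  -- Independence in the induced subgraph G[S].  Induced subgraphs are
  -- represented by their vertex subsets S of G.

  subsetB : Subset (n G) → Subset (n G) → Bool
  subsetB T S = all (λ v → not (mem T v) ∨ mem S v) verts

  indepB : Subset (n G) → Bool
  indepB T = all (λ u → all (λ v → not (mem T u ∧ mem T v ∧ adj G u v)) verts) verts

  indepInB : Subset (n G) → Subset (n G) → Bool
  indepInB S T = subsetB T S ∧ indepB T

  maxIndepInB : Subset (n G) → Subset (n G) → Bool
  maxIndepInB S T = indepInB S T ∧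
    all (λ v → not (mem S v) ∨ mem T v ∨ inNbhB T v) verts

allSubsets : (m : ℕ) → List (Subset m)
allSubsets zero    = [ [] ]
allSubsets (suc m) = map (inside ∷_) (allSubsets m) ++ map (outside ∷_) (allSubsets m)

module _ (G : Graph) where

  αOn : Subset (n G) → ℕ
  αOn S = foldr _⊔_ 0 (map ∣_∣ (filterᵇ (indepInB G S)
                                        (allSubsets (n G))))

  -- i(G[S]) : minimum size of a maximal independent set of G[S]
  -- (the list is never empty, so the default value n G is never returned)
  iOn : Subset (n G) → ℕ
  iOn S = foldr _⊓_ (n G) (map ∣_∣ (filterᵇ (maxIndepInB G S)
                                        (allSubsets (n G))))

  minusNbh : Subset (n G) → Subset (n G) → Subset (n G)
  minusNbh S I = tabulate (λ v → mem G S v ∧ not (inNbhB G I v))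

  WellCoveredOn : Subset (n G) → Set
  WellCoveredOn S = αOn S ≡ iOn S

  -- μ_α(G) = 1  (note i ≤ α always, so this is α(G) = i(G) + 1)
  AlmostWellCovered : Set
  AlmostWellCovered = αOn (allV G) ≡ suc (iOn (allV G))

module Submission where

-- Every vertex is a leaf, of type 0, or a support (of type 1, or x), and every leaf hangs on
-- exactly one support. Counting the leaves of an independent set S at their supports gives
-- |S| ≤ |S ∩ V(G₀)| + ℓ, where ℓ is the number of leaves, with |S| + [x ∈ S] = |S ∩ V(G₀)| + ℓ when
-- S is maximal. Conversely, for I an independent set of supports and T maximal in G₀ − N(I), the set
-- I ∪ T ∪ (leaves outside N(I)) is maximal in G. Hence α(G) = α(G₀) + ℓ, while i(G) is governed by
-- the quantities i(G₀ − N(I)) + ℓ − [x ∈ I]; both directions compare these. Girth ≥ 6 enters through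
-- the fact that x has no neighbour y of type 0 when G is almost well-covered: otherwise, for a suitable
-- independent set I′ ∋ x, some maximal independent set M of G₀ − N(I′) with |M| ≥ α(G₀) would stay
-- independent after adding y.

open import Data.Bool using (Bool; true; false; _∧_; _∨_; not; if_then_else_)
open import Data.Bool.Properties using (∧-identityʳ; ∧-zeroʳ)
open import Data.Bool.ListAction using (all; any)
open import Data.Empty using (⊥; ⊥-elim)
open import Data.Fin using (Fin; zero; suc; toℕ)
import Data.Fin.Properties as Finₚ
open import Data.Fin.Subset using (Subset; ∣_∣; ⁅_⁆; _∪_) renaming (⊥ to ∅)
import Data.Fin.Subset as Sub
open import Data.Fin.Subset.Properties
  using (∣p∣≤n; p⊂q⇒∣p∣<∣q∣; p⊆p∪q; q⊆p∪q; x∈p∪q⁻; x∈⁅x⁆; x∈⁅y⁆⇒x≡y)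
open import Data.List using (List; []; _∷_; map; _++_; filterᵇ; length; foldr; lookup)
import Data.List as List
open import Data.List.Membership.Propositional using (_∈_)
open import Data.List.Membership.Propositional.Properties using (∈-lookup; ∈-map⁺; ∈-++⁺ˡ; ∈-++⁺ʳ)
open import Data.List.Relation.Unary.All as All using (All; []; _∷_)
open import Data.List.Relation.Unary.AllPairs using (AllPairs; []; _∷_)
open import Data.List.Relation.Unary.Any using (here; there)
open import Data.Nat using (ℕ; zero; suc; _+_; _≤_; _<_; z≤n; s≤s; s≤s⁻¹; _⊔_; _⊓_; _%_) renaming (_≟_ to _≟ℕ_)
open import Data.Nat.DivMod using (_mod_; m<n⇒m%n≡m; n%n≡0)
open import Data.Nat.Properties
open import Data.Product using (_×_; Σ; _,_; proj₁; proj₂)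
open import Data.Sum using (_⊎_; inj₁; inj₂; [_,_]′)
open import Data.Vec using ([]; _∷_; tabulate) renaming (lookup to _!_)
open import Data.Vec.Properties using (tabulate-cong; lookup∘tabulate; lookup-replicate; []=⇒lookup; lookup⇒[]=)
open import Function using (_∘_; Injective; _⇔_; mk⇔)
open import Relation.Binary.PropositionalEquality
  using (_≡_; _≢_; refl; sym; trans; cong; cong₂; subst; subst₂; module ≡-Reasoning)
open import Relation.Nullary using (¬_; Dec; yes; no)
open import Relation.Nullary.Decidable using (⌊_⌋)
open import Defs renaming (sym to adj-comm)

open import Algebra.Properties.CommutativeMonoid.Sum +-0-commutativeMonoid
  using (sum; sum-cong-≗; sum-replicate-zero; ∑-distrib-+; ∑-comm)
open import Algebra.Properties.CommutativeSemigroup +-commutativeSemigroup using (xy∙z≈xz∙y)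

∧-trueˡ : ∀ {a b} → a ∧ b ≡ true → a ≡ true
∧-trueˡ {true} _ = refl

∧-trueʳ : ∀ {a b} → a ∧ b ≡ true → b ≡ true
∧-trueʳ {true} p = p

∧-true : ∀ {a b} → a ≡ true → b ≡ true → a ∧ b ≡ true
∧-true refl refl = refl

∧-falseˡ : ∀ {a} b → a ≡ false → a ∧ b ≡ false
∧-falseˡ b refl = refl

∧-falseʳ : ∀ a {b} → b ≡ false → a ∧ b ≡ false
∧-falseʳ true  refl = refl
∧-falseʳ false refl = refl

∧-∧-true⇒∧ : ∀ a b {c} → a ∧ (b ∧ c) ≡ true → a ∧ b ≡ true
∧-∧-true⇒∧ true true _ = refl

∨-true⁻ : ∀ {a b} → a ∨ b ≡ true → a ≡ true ⊎ b ≡ true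
∨-true⁻ {true}  _ = inj₁ refl
∨-true⁻ {false} p = inj₂ p

∨-trueˡ : ∀ {a} b → a ≡ true → a ∨ b ≡ true
∨-trueˡ b refl = refl

∨-trueʳ : ∀ a {b} → b ≡ true → a ∨ b ≡ true
∨-trueʳ true  refl = refl
∨-trueʳ false refl = refl

∨-false : ∀ {a b} → a ≡ false → b ≡ false → a ∨ b ≡ false
∨-false refl refl = refl

not-true⁻ : ∀ {a} → not a ≡ true → a ≡ false
not-true⁻ {false} _ = refl

not-false : ∀ {a} → a ≡ false → not a ≡ true
not-false refl = refl

not-true : ∀ {a} → a ≡ true → not a ≡ false
not-true refl = refl

true≢false : ∀ {a} → a ≡ true → a ≡ false → ⊥
true≢false refl ()

≢true⇒false : ∀ {a} → ¬ (a ≡ true) → a ≡ false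
≢true⇒false {true}  p = ⊥-elim (p refl)
≢true⇒false {false} _ = refl

≢false⇒true : ∀ {a} → ¬ (a ≡ false) → a ≡ true
≢false⇒true {true}  _ = refl
≢false⇒true {false} p = ⊥-elim (p refl)

true⇔true⇒≡ : ∀ {a b} → (a ≡ true → b ≡ true) → (b ≡ true → a ≡ true) → a ≡ b
true⇔true⇒≡ {true}  {true}  _ _ = refl
true⇔true⇒≡ {true}  {false} f _ = sym (f refl)
true⇔true⇒≡ {false} {true}  _ g = g refl
true⇔true⇒≡ {false} {false} _ _ = refl

true-or-false : ∀ b → b ≡ true ⊎ b ≡ false
true-or-false true  = inj₁ refl
true-or-false false = inj₂ refl

⌊⌋-true⁻ : ∀ {P : Set} (d : Dec P) → ⌊ d ⌋ ≡ true → P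
⌊⌋-true⁻ (yes p) _ = p

⌊⌋-true : ∀ {P : Set} (d : Dec P) → P → ⌊ d ⌋ ≡ true
⌊⌋-true (yes _) _ = refl
⌊⌋-true (no ¬p) p = ⊥-elim (¬p p)

⌊⌋-false : ∀ {P : Set} (d : Dec P) → ¬ P → ⌊ d ⌋ ≡ false
⌊⌋-false (yes p) ¬p = ⊥-elim (¬p p)
⌊⌋-false (no _)  _  = refl

𝟙 : Bool → ℕ
𝟙 true  = 1
𝟙 false = 0

count : ∀ {m} → (Fin m → Bool) → ℕ
count p = sum (𝟙 ∘ p)

sum-zero : ∀ {m} {f : Fin m → ℕ} → (∀ i → f i ≡ 0) → sum f ≡ 0
sum-zero {m} f≗0 = trans (sum-cong-≗ f≗0) (sum-replicate-zero m)

sum-mono-≤ : ∀ {m} {f g : Fin m → ℕ} → (∀ i → f i ≤ g i) → sum f ≤ sum g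
sum-mono-≤ {zero}  _   = z≤n
sum-mono-≤ {suc m} f≤g = +-mono-≤ (f≤g zero) (sum-mono-≤ (f≤g ∘ suc))

≤-sum : ∀ {m} (f : Fin m → ℕ) a → f a ≤ sum f
≤-sum f zero    = m≤m+n _ _
≤-sum f (suc a) = ≤-trans (≤-sum (f ∘ suc) a) (m≤n+m _ (f zero))

+≤-sum : ∀ {m} (f : Fin m → ℕ) {a b} → a ≢ b → f a + f b ≤ sum f
+≤-sum f {zero}  {zero}  a≢b = ⊥-elim (a≢b refl)
+≤-sum f {zero}  {suc b} _   = +-monoʳ-≤ (f zero) (≤-sum (f ∘ suc) b)
+≤-sum f {suc a} {zero}  _   =
  subst (_≤ sum f) (+-comm (f zero) (f (suc a))) (+-monoʳ-≤ (f zero) (≤-sum (f ∘ suc) a))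
+≤-sum f {suc a} {suc b} a≢b =
  ≤-trans (+≤-sum (f ∘ suc) (a≢b ∘ cong suc)) (m≤n+m _ (f zero))

sum-single : ∀ {m} (f : Fin m → ℕ) a → (∀ i → i ≢ a → f i ≡ 0) → sum f ≡ f a
sum-single f zero    f≡0 = trans (cong (f zero +_) (sum-zero (λ i → f≡0 (suc i) λ ()))) (+-identityʳ _)
sum-single f (suc a) f≡0 =
  cong₂ _+_ (f≡0 zero λ ()) (sum-single (f ∘ suc) a (λ i i≢a → f≡0 (suc i) (i≢a ∘ Finₚ.suc-injective)))

count-cong : ∀ {m} {p q : Fin m → Bool} → (∀ i → p i ≡ q i) → count p ≡ count q
count-cong p≗q = sum-cong-≗ (cong 𝟙 ∘ p≗q)

count-mono : ∀ {m} {p q : Fin m → Bool} → (∀ i → p i ≡ true → q i ≡ true) → count p ≤ count q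
count-mono {p = p} {q} p⇒q = sum-mono-≤ 𝟙-mono
  where
  𝟙-mono : ∀ i → 𝟙 (p i) ≤ 𝟙 (q i)
  𝟙-mono i with p i in pi
  ... | false = z≤n
  ... | true rewrite p⇒q i pi = ≤-refl

count-single : ∀ {m} (p : Fin m → Bool) a → (∀ i → i ≢ a → p i ≡ false) → count p ≡ 𝟙 (p a)
count-single p a p≡false = sum-single (𝟙 ∘ p) a (λ i i≢a → cong 𝟙 (p≡false i i≢a))

count-pos : ∀ {m} {p : Fin m → Bool} a → p a ≡ true → 1 ≤ count p
count-pos {p = p} a pa = ≤-trans (≤-reflexive (cong 𝟙 (sym pa))) (≤-sum (𝟙 ∘ p) a)

count-pos⁻ : ∀ {m} (p : Fin m → Bool) → 1 ≤ count p → Σ (Fin m) λ i → p i ≡ true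
count-pos⁻ {zero}  p ()
count-pos⁻ {suc m} p c with p zero in p0
... | true  = zero , p0
... | false = let i , pi = count-pos⁻ (p ∘ suc) c in suc i , pi

count≡1⇒unique : ∀ {m} {p : Fin m → Bool} → count p ≡ 1 → ∀ {a b} → p a ≡ true → p b ≡ true → a ≡ b
count≡1⇒unique {p = p} c≡1 {a} {b} pa pb with a Finₚ.≟ b
... | yes a≡b = a≡b
... | no  a≢b = ⊥-elim (1+n≰n (subst₂ _≤_ (cong₂ (λ x y → 𝟙 x + 𝟙 y) pa pb) c≡1 (+≤-sum (𝟙 ∘ p) a≢b)))

count≥2⇒∃≢ : ∀ {m} {p : Fin m → Bool} → 2 ≤ count p → ∀ y → Σ (Fin m) λ z → z ≢ y × p z ≡ true
count≥2⇒∃≢ {m} {p} 2≤c y =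
  let z , pz∧z≢y = count-pos⁻ p∖y (s≤s⁻¹ (≤-trans 2≤c count≤))
  in z , (λ z≡y → true≢false (⌊⌋-true (y Finₚ.≟ z) (sym z≡y)) (not-true⁻ (∧-trueʳ pz∧z≢y))) , ∧-trueˡ pz∧z≢y
  where
  is-y : Fin m → Bool
  is-y i = ⌊ y Finₚ.≟ i ⌋
  p∖y : Fin m → Bool
  p∖y i = p i ∧ not (is-y i)
  split : ∀ i → 𝟙 (p i) ≤ 𝟙 (p∖y i) + 𝟙 (is-y i)
  split i with p i | is-y i
  ... | true  | true  = s≤s z≤n
  ... | true  | false = ≤-refl
  ... | false | _     = z≤n
  count-is-y : count is-y ≡ 1
  count-is-y = trans (count-single is-y y (λ i i≢y → ⌊⌋-false (y Finₚ.≟ i) (i≢y ∘ sym)))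
                     (cong 𝟙 (⌊⌋-true (y Finₚ.≟ y) refl))
  count≤ : count p ≤ suc (count p∖y)
  count≤ = begin
    count p                             ≤⟨ sum-mono-≤ split ⟩
    sum (λ i → 𝟙 (p∖y i) + 𝟙 (is-y i))  ≡⟨ ∑-distrib-+ (𝟙 ∘ p∖y) (𝟙 ∘ is-y) ⟩
    count p∖y + count is-y              ≡⟨ cong (count p∖y +_) count-is-y ⟩
    count p∖y + 1                       ≡⟨ +-comm (count p∖y) 1 ⟩
    suc (count p∖y)                     ∎
    where open ≤-Reasoning

𝟙-partition : ∀ a b c s → 𝟙 a + 𝟙 b + 𝟙 c ≡ 1 → 𝟙 s ≡ 𝟙 (a ∧ s) + 𝟙 (b ∧ s) + 𝟙 (c ∧ s)
𝟙-partition true  false false s _ = sym (trans (+-identityʳ _) (+-identityʳ _))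
𝟙-partition false true  false s _ = sym (+-identityʳ _)
𝟙-partition false false true  s _ = refl
𝟙-partition true  true  _     s ()
𝟙-partition true  false true  s ()
𝟙-partition false true  true  s ()
𝟙-partition false false false s ()

if-mono-≤ : ∀ b {x y} → (b ≡ true → x ≤ y) → (if b then x else 0) ≤ (if b then y else 0)
if-mono-≤ true  x≤y = x≤y refl
if-mono-≤ false _   = z≤n

if-+𝟙 : ∀ b {x y e} → (b ≡ true → x + 𝟙 e ≡ y) → (b ≡ false → e ≡ false) →
  (if b then x else 0) + 𝟙 e ≡ (if b then y else 0)
if-+𝟙 true  on  _   = on refl
if-+𝟙 false _   off = cong 𝟙 (off refl)

sum-𝟙-∧ : ∀ {m} (p : Fin m → Bool) b → sum (λ v → 𝟙 (p v ∧ b)) ≡ (if b then count p else 0)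
sum-𝟙-∧ p true  = count-cong (λ v → ∧-identityʳ (p v))
sum-𝟙-∧ p false = sum-zero (λ v → cong 𝟙 (∧-zeroʳ (p v)))

∣∣≡count : ∀ {m} (S : Subset m) → ∣ S ∣ ≡ count (S !_)
∣∣≡count []          = refl
∣∣≡count (true  ∷ S) = cong suc (∣∣≡count S)
∣∣≡count (false ∷ S) = ∣∣≡count S

∣tabulate∣≡count : ∀ {m} (f : Fin m → Bool) → ∣ tabulate f ∣ ≡ count f
∣tabulate∣≡count f = trans (∣∣≡count (tabulate f)) (count-cong (lookup∘tabulate f))

length-filter-tabulate : ∀ {A : Set} {m} (p : A → Bool) (f : Fin m → A) →
  length (filterᵇ p (List.tabulate f)) ≡ count (p ∘ f)
length-filter-tabulate {m = zero}  p f = refl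
length-filter-tabulate {m = suc m} p f with p (f zero)
... | true  = cong suc (length-filter-tabulate p (f ∘ suc))
... | false = length-filter-tabulate p (f ∘ suc)

any-tabulate⁻ : ∀ {A : Set} {m} (p : A → Bool) (f : Fin m → A) →
  any p (List.tabulate f) ≡ true → Σ (Fin m) λ i → p (f i) ≡ true
any-tabulate⁻ {m = suc m} p f q with p (f zero) in eq
... | true  = zero , eq
... | false = let i , r = any-tabulate⁻ p (f ∘ suc) q in suc i , r

any-tabulate⁺ : ∀ {A : Set} {m} (p : A → Bool) (f : Fin m → A) i → p (f i) ≡ true →
  any p (List.tabulate f) ≡ true
any-tabulate⁺ p f zero    q rewrite q = refl
any-tabulate⁺ p f (suc i) q = ∨-trueʳ (p (f zero)) (any-tabulate⁺ p (f ∘ suc) i q)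

all-tabulate⁻ : ∀ {A : Set} {m} (p : A → Bool) (f : Fin m → A) →
  all p (List.tabulate f) ≡ true → ∀ i → p (f i) ≡ true
all-tabulate⁻ p f q zero    = ∧-trueˡ q
all-tabulate⁻ p f q (suc i) = all-tabulate⁻ p (f ∘ suc) (∧-trueʳ q) i

all-tabulate⁺ : ∀ {A : Set} {m} (p : A → Bool) (f : Fin m → A) →
  (∀ i → p (f i) ≡ true) → all p (List.tabulate f) ≡ true
all-tabulate⁺ {m = zero}  p f q = refl
all-tabulate⁺ {m = suc m} p f q = ∧-true (q zero) (all-tabulate⁺ p (f ∘ suc) (q ∘ suc))

allSubsets-complete : ∀ {m} (S : Subset m) → S ∈ allSubsets m
allSubsets-complete [] = here refl
allSubsets-complete {suc m} (true ∷ S) = ∈-++⁺ˡ (∈-map⁺ (true ∷_) (allSubsets-complete S))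
allSubsets-complete {suc m} (false ∷ S) =
  ∈-++⁺ʳ (map (true ∷_) (allSubsets m)) (∈-map⁺ (false ∷_) (allSubsets-complete S))

-- αOn and iOn unfold to maxSize and minSize over allSubsets.
module _ {m : ℕ} (p : Subset m → Bool) where

  maxSize : List (Subset m) → ℕ
  maxSize xs = foldr _⊔_ 0 (map ∣_∣ (filterᵇ p xs))

  minSize : ℕ → List (Subset m) → ℕ
  minSize d xs = foldr _⊓_ d (map ∣_∣ (filterᵇ p xs))

  ≤-maxSize : ∀ {xs T} → T ∈ xs → p T ≡ true → ∣ T ∣ ≤ maxSize xs
  ≤-maxSize {y ∷ xs} (here refl) pT rewrite pT = m≤m⊔n _ _
  ≤-maxSize {y ∷ xs} (there T∈xs) pT with p y
  ... | true  = ≤-trans (≤-maxSize T∈xs pT) (m≤n⊔m _ _)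
  ... | false = ≤-maxSize T∈xs pT

  maxSize-attained : ∀ xs → maxSize xs ≡ 0 ⊎ Σ (Subset m) λ T → p T ≡ true × ∣ T ∣ ≡ maxSize xs
  maxSize-attained [] = inj₁ refl
  maxSize-attained (y ∷ xs) with p y in py
  ... | false = maxSize-attained xs
  ... | true with ⊔-sel ∣ y ∣ (maxSize xs)
  ...   | inj₁ e = inj₂ (y , py , sym e)
  ...   | inj₂ e with maxSize-attained xs
  ...     | inj₁ z = inj₁ (trans e z)
  ...     | inj₂ (T , pT , e′) = inj₂ (T , pT , trans e′ (sym e))

  minSize-≤ : ∀ d {xs T} → T ∈ xs → p T ≡ true → minSize d xs ≤ ∣ T ∣
  minSize-≤ d {y ∷ xs} (here refl) pT rewrite pT = m⊓n≤m _ _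
  minSize-≤ d {y ∷ xs} (there T∈xs) pT with p y
  ... | true  = ≤-trans (m⊓n≤n _ _) (minSize-≤ d T∈xs pT)
  ... | false = minSize-≤ d T∈xs pT

  minSize-attained : ∀ d xs → minSize d xs ≡ d ⊎ Σ (Subset m) λ T → p T ≡ true × ∣ T ∣ ≡ minSize d xs
  minSize-attained d [] = inj₁ refl
  minSize-attained d (y ∷ xs) with p y in py
  ... | false = minSize-attained d xs
  ... | true with ⊓-sel ∣ y ∣ (minSize d xs)
  ...   | inj₁ e = inj₂ (y , py , sym e)
  ...   | inj₂ e with minSize-attained d xs
  ...     | inj₁ z = inj₁ (trans e z)
  ...     | inj₂ (T , pT , e′) = inj₂ (T , pT , trans e′ (sym e))

module _ {m : ℕ} where

  ∈⇒lookup : ∀ {v : Fin m} {S} → v Sub.∈ S → S ! v ≡ true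
  ∈⇒lookup = []=⇒lookup

  lookup⇒∈ : ∀ {v : Fin m} {S} → S ! v ≡ true → v Sub.∈ S
  lookup⇒∈ = lookup⇒[]= _ _

  lookup-∪⁅⁆⁻ : ∀ (S : Subset m) {v u} → (S ∪ ⁅ v ⁆) ! u ≡ true → S ! u ≡ true ⊎ u ≡ v
  lookup-∪⁅⁆⁻ S {v} p with x∈p∪q⁻ S ⁅ v ⁆ (lookup⇒∈ p)
  ... | inj₁ u∈S  = inj₁ (∈⇒lookup u∈S)
  ... | inj₂ u∈v = inj₂ (x∈⁅y⁆⇒x≡y v u∈v)

  lookup-∪⁅⁆-new : ∀ (S : Subset m) v → (S ∪ ⁅ v ⁆) ! v ≡ true
  lookup-∪⁅⁆-new S v = ∈⇒lookup (q⊆p∪q S ⁅ v ⁆ (x∈⁅x⁆ v))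

  lookup-∪⁅⁆-old : ∀ (S : Subset m) {u} v → S ! u ≡ true → (S ∪ ⁅ v ⁆) ! u ≡ true
  lookup-∪⁅⁆-old S v Su = ∈⇒lookup (p⊆p∪q ⁅ v ⁆ (lookup⇒∈ {S = S} Su))

  ∣S∣<∣S∪⁅v⁆∣ : ∀ (S : Subset m) {v} → S ! v ≡ false → ∣ S ∣ < ∣ S ∪ ⁅ v ⁆ ∣
  ∣S∣<∣S∪⁅v⁆∣ S {v} v∉S = p⊂q⇒∣p∣<∣q∣ (p⊆p∪q ⁅ v ⁆ , v , q⊆p∪q S ⁅ v ⁆ (x∈⁅x⁆ v) ,
                                       λ v∈S → true≢false (∈⇒lookup v∈S) v∉S)

-- Independent sets of induced subgraphs

module Independence (G : Graph) where

  eqB-true⁻ : ∀ {u v} → eqB G u v ≡ true → u ≡ v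
  eqB-true⁻ {u} {v} = ⌊⌋-true⁻ (u Finₚ.≟ v)

  eqB-refl : ∀ u → eqB G u u ≡ true
  eqB-refl u = ⌊⌋-true (u Finₚ.≟ u) refl

  eqB-false : ∀ {u v} → u ≢ v → eqB G u v ≡ false
  eqB-false {u} {v} = ⌊⌋-false (u Finₚ.≟ v)

  adj-sym : ∀ {u v} → Adj G u v → Adj G v u
  adj-sym {u} {v} = trans (adj-comm G v u)

  adj-symᶠ : ∀ {u v} → adj G u v ≡ false → adj G v u ≡ false
  adj-symᶠ {u} {v} = trans (adj-comm G v u)

  adj⇒≢ : ∀ {u v} → Adj G u v → u ≢ v
  adj⇒≢ {u} uv refl = true≢false uv (irrefl G u)

  _⊆_ : Subset (n G) → Subset (n G) → Set
  T ⊆ S = ∀ v → T ! v ≡ true → S ! v ≡ true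

  Independent : Subset (n G) → Set
  Independent T = ∀ u v → T ! u ≡ true → T ! v ≡ true → adj G u v ≡ false

  Dominates : Subset (n G) → Subset (n G) → Set
  Dominates T S = ∀ v → S ! v ≡ true → T ! v ≡ false → Σ (Vtx G) λ u → T ! u ≡ true × Adj G u v

  inNbhB-true⁻ : ∀ I v → inNbhB G I v ≡ true → Σ (Vtx G) λ u → I ! u ≡ true × Adj G u v
  inNbhB-true⁻ I v p = let u , q = any-tabulate⁻ (λ u → mem G I u ∧ adj G u v) (λ i → i) p
                       in u , ∧-trueˡ q , ∧-trueʳ q

  inNbhB-true : ∀ I {u v} → I ! u ≡ true → Adj G u v → inNbhB G I v ≡ true
  inNbhB-true I {u} {v} p q = any-tabulate⁺ (λ u → mem G I u ∧ adj G u v) (λ i → i) u (∧-true p q)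

  inNbhB-false : ∀ I v → (∀ u → I ! u ≡ true → adj G u v ≡ false) → inNbhB G I v ≡ false
  inNbhB-false I v h = ≢true⇒false λ p → let u , q , r = inNbhB-true⁻ I v p in true≢false r (h u q)

  subsetB⁻ : ∀ T S → subsetB G T S ≡ true → T ⊆ S
  subsetB⁻ T S p v q with all-tabulate⁻ (λ v → not (mem G T v) ∨ mem G S v) (λ i → i) p v
  ... | r rewrite q = r

  subsetB⁺ : ∀ T S → T ⊆ S → subsetB G T S ≡ true
  subsetB⁺ T S T⊆S = all-tabulate⁺ _ (λ i → i) member
    where
    member : ∀ v → not (T ! v) ∨ S ! v ≡ true
    member v with T ! v in Tv
    ... | false = refl
    ... | true  = T⊆S v Tv

  indepB⁻ : ∀ T → indepB G T ≡ true → Independent T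
  indepB⁻ T p u v Tu Tv =
    not-true⁻ (subst (λ b → not b ≡ true) (cong₂ (λ a b → a ∧ b ∧ adj G u v) Tu Tv)
                     (all-tabulate⁻ _ (λ i → i) (all-tabulate⁻ _ (λ i → i) p u) v))

  indepB⁺ : ∀ T → Independent T → indepB G T ≡ true
  indepB⁺ T ind = all-tabulate⁺ _ (λ i → i) (λ u → all-tabulate⁺ _ (λ i → i) (nonEdge u))
    where
    nonEdge : ∀ u v → not (T ! u ∧ T ! v ∧ adj G u v) ≡ true
    nonEdge u v with T ! u in Tu | T ! v in Tv
    ... | false | _     = refl
    ... | true  | false = refl
    ... | true  | true rewrite ind u v Tu Tv = refl

  indepInB⁻ : ∀ S T → indepInB G S T ≡ true → T ⊆ S × Independent T
  indepInB⁻ S T p = subsetB⁻ T S (∧-trueˡ p) , indepB⁻ T (∧-trueʳ p)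

  indepInB⁺ : ∀ S T → T ⊆ S → Independent T → indepInB G S T ≡ true
  indepInB⁺ S T T⊆S ind = ∧-true (subsetB⁺ T S T⊆S) (indepB⁺ T ind)

  maxIndepInB⁻ : ∀ S T → maxIndepInB G S T ≡ true → T ⊆ S × Independent T × Dominates T S
  maxIndepInB⁻ S T p = proj₁ (indepInB⁻ S T (∧-trueˡ p)) , proj₂ (indepInB⁻ S T (∧-trueˡ p)) , dom
    where
    dom : Dominates T S
    dom v Sv Tv with all-tabulate⁻ (λ v → not (mem G S v) ∨ mem G T v ∨ inNbhB G T v) (λ i → i) (∧-trueʳ p) v
    ... | r rewrite Sv | Tv = inNbhB-true⁻ T v r

  maxIndepInB⁺ : ∀ S T → T ⊆ S → Independent T → Dominates T S → maxIndepInB G S T ≡ true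
  maxIndepInB⁺ S T T⊆S ind dom = ∧-true (indepInB⁺ S T T⊆S ind) (all-tabulate⁺ _ (λ i → i) covered)
    where
    covered : ∀ v → not (S ! v) ∨ T ! v ∨ inNbhB G T v ≡ true
    covered v with S ! v in Sv | T ! v in Tv
    ... | false | _     = refl
    ... | true  | true  = refl
    ... | true  | false = let u , Tu , uv = dom v Sv Tv in inNbhB-true T Tu uv

  lookup-allV : ∀ v → allV G ! v ≡ true
  lookup-allV = lookup∘tabulate (λ _ → true)

  lookup-∅ : ∀ v → ∅ {n G} ! v ≡ false
  lookup-∅ v = lookup-replicate v false

  ∅-independent : Independent ∅
  ∅-independent u _ ∅u _ = ⊥-elim (true≢false ∅u (lookup-∅ u))

  ∅-⊆ : ∀ S → ∅ ⊆ S
  ∅-⊆ _ v ∅v = ⊥-elim (true≢false ∅v (lookup-∅ v))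

  inNbhB-∅ : ∀ v → inNbhB G ∅ v ≡ false
  inNbhB-∅ v = inNbhB-false ∅ v (λ u ∅u → ⊥-elim (true≢false ∅u (lookup-∅ u)))

  lookup-minusNbh⁻ : ∀ S I v → minusNbh G S I ! v ≡ true → S ! v ≡ true × inNbhB G I v ≡ false
  lookup-minusNbh⁻ S I v p = let q = trans (sym (lookup∘tabulate _ v)) p in ∧-trueˡ q , not-true⁻ (∧-trueʳ q)

  lookup-minusNbh⁺ : ∀ S I v → S ! v ≡ true → inNbhB G I v ≡ false → minusNbh G S I ! v ≡ true
  lookup-minusNbh⁺ S I v Sv I↛v = trans (lookup∘tabulate _ v) (∧-true Sv (not-false I↛v))

  ≤-αOn : ∀ S T → T ⊆ S → Independent T → ∣ T ∣ ≤ αOn G S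
  ≤-αOn S T T⊆S ind = ≤-maxSize (indepInB G S) (allSubsets-complete T) (indepInB⁺ S T T⊆S ind)

  iOn-≤ : ∀ S T → maxIndepInB G S T ≡ true → iOn G S ≤ ∣ T ∣
  iOn-≤ S T = minSize-≤ (maxIndepInB G S) (n G) (allSubsets-complete T)

  record LargestExtension (S D : Subset (n G)) : Set where
    field
      set         : Subset (n G)
      ⊆S          : set ⊆ S
      independent : Independent set
      ⊇D          : D ⊆ set
      largest     : ∀ T → T ⊆ S → Independent T → D ⊆ T → ∣ T ∣ ≤ ∣ set ∣

    dominates : Dominates set S
    dominates v Sv v∉set with inNbhB G set v in set↛v
    ... | true  = inNbhB-true⁻ set v set↛v
    ... | false = ⊥-elim (<⇒≱ (∣S∣<∣S∪⁅v⁆∣ set v∉set) (largest (set ∪ ⁅ v ⁆) ⊆S′ independent′ ⊇D′))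
      where
      ⊆S′ : (set ∪ ⁅ v ⁆) ⊆ S
      ⊆S′ u p with lookup-∪⁅⁆⁻ set p
      ... | inj₁ q    = ⊆S u q
      ... | inj₂ refl = Sv
      notAdjV : ∀ u → set ! u ≡ true → adj G u v ≡ false
      notAdjV u q = ≢true⇒false λ uv → true≢false (inNbhB-true set q uv) set↛v
      independent′ : Independent (set ∪ ⁅ v ⁆)
      independent′ a b pa pb with lookup-∪⁅⁆⁻ set pa | lookup-∪⁅⁆⁻ set pb
      ... | inj₁ qa   | inj₁ qb   = independent a b qa qb
      ... | inj₁ qa   | inj₂ refl = notAdjV a qa
      ... | inj₂ refl | inj₁ qb   = adj-symᶠ (notAdjV b qb)
      ... | inj₂ refl | inj₂ refl = irrefl G v
      ⊇D′ : D ⊆ (set ∪ ⁅ v ⁆)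
      ⊇D′ u Du = lookup-∪⁅⁆-old set v (⊇D u Du)

    maximal : maxIndepInB G S set ≡ true
    maximal = maxIndepInB⁺ S set ⊆S independent dominates

  largestExtension : ∀ S D → D ⊆ S → Independent D → LargestExtension S D
  largestExtension S D D⊆S indD = fromAttained (maxSize-attained extends (allSubsets (n G)))
    where
    extends : Subset (n G) → Bool
    extends T = indepInB G S T ∧ subsetB G D T
    ≤-max : ∀ T → T ⊆ S → Independent T → D ⊆ T → ∣ T ∣ ≤ maxSize extends (allSubsets (n G))
    ≤-max T T⊆S indT D⊆T =
      ≤-maxSize extends (allSubsets-complete T) (∧-true (indepInB⁺ S T T⊆S indT) (subsetB⁺ D T D⊆T))
    fromAttained : maxSize extends (allSubsets (n G)) ≡ 0
                   ⊎ Σ (Subset (n G)) (λ M → extends M ≡ true × ∣ M ∣ ≡ maxSize extends (allSubsets (n G)))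
                 → LargestExtension S D
    fromAttained (inj₁ max≡0) = record
      { set = D ; ⊆S = D⊆S ; independent = indD ; ⊇D = λ _ p → p
      ; largest = λ T T⊆S indT D⊆T → ≤-trans (subst (∣ T ∣ ≤_) max≡0 (≤-max T T⊆S indT D⊆T)) z≤n }
    fromAttained (inj₂ (M , pM , ∣M∣≡max)) = record
      { set = M ; ⊆S = proj₁ (indepInB⁻ S M (∧-trueˡ pM)) ; independent = proj₂ (indepInB⁻ S M (∧-trueˡ pM))
      ; ⊇D = subsetB⁻ D M (∧-trueʳ pM)
      ; largest = λ T T⊆S indT D⊆T → subst (∣ T ∣ ≤_) (sym ∣M∣≡max) (≤-max T T⊆S indT D⊆T) }

  maximumIndependent : ∀ S → LargestExtension S ∅
  maximumIndependent S = largestExtension S ∅ (∅-⊆ S) ∅-independent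

  αOn≤maximumIndependent : ∀ S → αOn G S ≤ ∣ LargestExtension.set (maximumIndependent S) ∣
  αOn≤maximumIndependent S with maxSize-attained (indepInB G S) (allSubsets (n G))
  ... | inj₁ α≡0 = ≤-trans (≤-reflexive α≡0) z≤n
  ... | inj₂ (T , pT , ∣T∣≡α) = subst (_≤ _) ∣T∣≡α
    (LargestExtension.largest (maximumIndependent S) T (proj₁ (indepInB⁻ S T pT)) (proj₂ (indepInB⁻ S T pT)) (∅-⊆ T))

  iOn-attained : ∀ S → Σ (Subset (n G)) λ T → maxIndepInB G S T ≡ true × ∣ T ∣ ≡ iOn G S
  iOn-attained S with minSize-attained (maxIndepInB G S) (n G) (allSubsets (n G))
  ... | inj₂ attained = attained
  ... | inj₁ i≡n = set , maximal , ≤-antisym (subst (∣ set ∣ ≤_) (sym i≡n) (∣p∣≤n set)) (iOn-≤ S set maximal)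
    where open LargestExtension (maximumIndependent S)

-- Graphs of girth at least 6

cyclicSucc : ∀ {k} → Fin (suc k) → Fin (suc k)
cyclicSucc {k} i = suc (toℕ i) mod suc k

CyclicSucc⇒≡cyclicSucc : ∀ {k} {i j : Fin (suc k)} → CyclicSucc i j → j ≡ cyclicSucc i
CyclicSucc⇒≡cyclicSucc {k} {i} {j} c = Finₚ.toℕ-injective (trans (toℕ-j c) (sym (Finₚ.toℕ-fromℕ< _)))
  where
  toℕ-j : CyclicSucc i j → toℕ j ≡ suc (toℕ i) % suc k
  toℕ-j (inj₁ e)        = sym (trans (m<n⇒m%n≡m (subst (_< suc k) (sym e) (Finₚ.toℕ<n j))) e)
  toℕ-j (inj₂ (e , j≡0)) = trans j≡0 (sym (trans (cong (_% suc k) e) (n%n≡0 (suc k))))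

lookup-injective : ∀ {A : Set} {xs : List A} → AllPairs _≢_ xs → Injective _≡_ _≡_ (lookup xs)
lookup-injective {xs = x ∷ xs} (x≢xs ∷ d) {zero}  {zero}  _ = refl
lookup-injective {xs = x ∷ xs} (x≢xs ∷ d) {zero}  {suc j} e = ⊥-elim (All.lookup x≢xs (∈-lookup j) e)
lookup-injective {xs = x ∷ xs} (x≢xs ∷ d) {suc i} {zero}  e = ⊥-elim (All.lookup x≢xs (∈-lookup i) (sym e))
lookup-injective {xs = x ∷ xs} (x≢xs ∷ d) {suc i} {suc j} e = cong suc (lookup-injective d e)

module Girth (G : Graph) (girth : GirthAtLeast6 G) where

  noShortCycle : ∀ v vs → 2 ≤ length vs → length vs ≤ 4 → AllPairs _≢_ (v ∷ vs) →
    (∀ i → Adj G (lookup (v ∷ vs) i) (lookup (v ∷ vs) (cyclicSucc i))) → ⊥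
  noShortCycle v vs 2≤ ≤4 distinct steps = girth (length (v ∷ vs)) (s≤s 2≤) (s≤s ≤4) (lookup (v ∷ vs))
    ( lookup-injective distinct
    , λ i j i→j → subst (Adj G _ ∘ lookup (v ∷ vs)) (sym (CyclicSucc⇒≡cyclicSucc i→j)) (steps i))

  triangle-free : ∀ {a b c} → a ≢ b → a ≢ c → b ≢ c → Adj G a b → Adj G b c → Adj G c a → ⊥
  triangle-free ab ac bc e₀ e₁ e₂ =
    noShortCycle _ (_ ∷ _ ∷ []) (s≤s (s≤s z≤n)) (s≤s (s≤s z≤n))
      ((ab ∷ ac ∷ []) ∷ (bc ∷ []) ∷ [] ∷ [])
      λ { zero → e₀ ; (suc zero) → e₁ ; (suc (suc zero)) → e₂ }

  square-free : ∀ {a b c d} → a ≢ b → a ≢ c → a ≢ d → b ≢ c → b ≢ d → c ≢ d →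
    Adj G a b → Adj G b c → Adj G c d → Adj G d a → ⊥
  square-free ab ac ad bc bd cd e₀ e₁ e₂ e₃ =
    noShortCycle _ (_ ∷ _ ∷ _ ∷ []) (s≤s (s≤s z≤n)) (s≤s (s≤s (s≤s z≤n)))
      ((ab ∷ ac ∷ ad ∷ []) ∷ (bc ∷ bd ∷ []) ∷ (cd ∷ []) ∷ [] ∷ [])
      λ { zero → e₀ ; (suc zero) → e₁ ; (suc (suc zero)) → e₂ ; (suc (suc (suc zero))) → e₃ }

  pentagon-free : ∀ {a b c d e} → a ≢ b → a ≢ c → a ≢ d → a ≢ e → b ≢ c → b ≢ d → b ≢ e →
    c ≢ d → c ≢ e → d ≢ e → Adj G a b → Adj G b c → Adj G c d → Adj G d e → Adj G e a → ⊥
  pentagon-free ab ac ad ae bc bd be cd ce de e₀ e₁ e₂ e₃ e₄ =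
    noShortCycle _ (_ ∷ _ ∷ _ ∷ _ ∷ []) (s≤s (s≤s z≤n)) (s≤s (s≤s (s≤s (s≤s z≤n))))
      ((ab ∷ ac ∷ ad ∷ ae ∷ []) ∷ (bc ∷ bd ∷ be ∷ []) ∷ (cd ∷ ce ∷ []) ∷ (de ∷ []) ∷ [] ∷ [])
      λ { zero → e₀ ; (suc zero) → e₁ ; (suc (suc zero)) → e₂ ; (suc (suc (suc zero))) → e₃
        ; (suc (suc (suc (suc zero)))) → e₄ }

-- Connected components and the set U

distinct⇒2≤ : ∀ {m} {u v : Fin m} → u ≢ v → 2 ≤ m
distinct⇒2≤ {suc zero}    {zero} {zero} u≢v = ⊥-elim (u≢v refl)
distinct⇒2≤ {suc (suc m)} _                 = s≤s (s≤s z≤n)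

module Components (G : Graph) where
  open Independence G

  reach-mono : ∀ {k} j {u v} → k ≤ j → reach G k u v ≡ true → reach G j u v ≡ true
  reach-mono (suc j) k≤j p with m≤n⇒m<n∨m≡n k≤j
  ... | inj₁ (s≤s k≤j′) = ∨-trueˡ _ (reach-mono j k≤j′ p)
  ... | inj₂ refl       = p
  reach-mono zero z≤n p = p

  reach-step : ∀ k {u w v} → reach G k u w ≡ true → Adj G w v → reach G (suc k) u v ≡ true
  reach-step k {u} {w} {v} p q =
    ∨-trueʳ (reach G k u v) (any-tabulate⁺ (λ w → reach G k u w ∧ adj G w v) (λ i → i) w (∧-true p q))

  sameComp-refl : ∀ u → sameComp G u u ≡ true
  sameComp-refl u = reach-mono (n G) z≤n (eqB-refl u)

  sameComp-path₂ : ∀ {u a b} → Adj G u a → Adj G a b → u ≢ b → sameComp G u b ≡ true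
  sameComp-path₂ {u} ua ab u≢b = reach-mono (n G) (distinct⇒2≤ u≢b) (reach-step 1 (reach-step 0 (eqB-refl u) ua) ab)

  inU⁻ : ∀ {u a b} → inU G u ≡ true → sameComp G u a ≡ true → sameComp G u b ≡ true → a ≢ b → Adj G a b
  inU⁻ {u} {a} {b} p ua ub a≢b =
    complete ua ub (eqB-false a≢b) (all-tabulate⁻ _ (λ i → i) (all-tabulate⁻ _ (λ i → i) p a) b)
    where
    complete : ∀ {p q r c} → p ≡ true → q ≡ true → r ≡ false → not (p ∧ q ∧ not r) ∨ c ≡ true → c ≡ true
    complete refl refl refl e = e

  inU⁺ : ∀ u → (∀ a b → sameComp G u a ≡ true → sameComp G u b ≡ true → a ≢ b → Adj G a b) → inU G u ≡ true
  inU⁺ u complete = all-tabulate⁺ _ (λ i → i) λ a → all-tabulate⁺ _ (λ i → i) λ b →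
    fromComplete (sameComp G u a) (sameComp G u b) (eqB G a b) (adj G a b)
      (λ ua ub a≢b → complete a b ua ub (λ a≡b → true≢false (subst (λ c → eqB G a c ≡ true) a≡b (eqB-refl a)) a≢b))
    where
    fromComplete : ∀ p q r c → (p ≡ true → q ≡ true → r ≡ false → c ≡ true) → not (p ∧ q ∧ not r) ∨ c ≡ true
    fromComplete true  true  false c k = k refl refl refl
    fromComplete true  true  true  c k = refl
    fromComplete true  false r     c k = refl
    fromComplete false q     r     c k = refl

  inU-adj₂ : ∀ {u a b} → inU G u ≡ true → Adj G u a → Adj G a b → u ≢ b → Adj G u b
  inU-adj₂ {u} Uu ua ab u≢b = inU⁻ Uu (sameComp-refl u) (sameComp-path₂ ua ab u≢b) u≢b

-- Leaves and types

module Types (G : Graph) (girth : GirthAtLeast6 G) where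
  open Independence G
  open Components G
  open Girth G girth

  countB≡count : ∀ p → countB G p ≡ count p
  countB≡count p = length-filter-tabulate p (λ i → i)

  hasType⁻ : ∀ {k v} → hasType G k v ≡ true →
    (inU G v ≡ true × k ≡ 0) ⊎ (internal G v ≡ true × leafNbrs G v ≡ k)
  hasType⁻ p = [ (λ q → inj₂ (∧-trueˡ q , ⌊⌋-true⁻ (_ ≟ℕ _) (∧-trueʳ q)))
               , (λ q → inj₁ (∧-trueˡ q , ⌊⌋-true⁻ (_ ≟ℕ _) (∧-trueʳ q))) ]′ (∨-true⁻ p)

  positiveType⁻ : ∀ {k v} → hasType G (suc k) v ≡ true → internal G v ≡ true × leafNbrs G v ≡ suc k
  positiveType⁻ p = [ (λ { (_ , ()) }) , (λ q → q) ]′ (hasType⁻ p)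

  internal⇒∉U : ∀ {v} → internal G v ≡ true → inU G v ≡ false
  internal⇒∉U p = not-true⁻ (∧-trueˡ p)

  inU⇒type0 : ∀ {v} → inU G v ≡ true → hasType G 0 v ≡ true
  inU⇒type0 {v} p = ∨-trueʳ (internal G v ∧ _) (∧-true p (⌊⌋-true (0 ≟ℕ 0) refl))

  internal⇒hasType : ∀ {v} → internal G v ≡ true → hasType G (leafNbrs G v) v ≡ true
  internal⇒hasType p = ∨-trueˡ _ (∧-true p (⌊⌋-true (_ ≟ℕ _) refl))

  hasType-unique : ∀ {j k v} → hasType G j v ≡ true → hasType G k v ≡ true → j ≡ k
  hasType-unique p q = compare (hasType⁻ p) (hasType⁻ q)
    where
    compare : ∀ {j k v} → (inU G v ≡ true × j ≡ 0) ⊎ (internal G v ≡ true × leafNbrs G v ≡ j)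
                        → (inU G v ≡ true × k ≡ 0) ⊎ (internal G v ≡ true × leafNbrs G v ≡ k) → j ≡ k
    compare (inj₁ (_ , j≡0))  (inj₁ (_ , k≡0))  = trans j≡0 (sym k≡0)
    compare (inj₁ (Uv , _))   (inj₂ (iv , _))   = ⊥-elim (true≢false Uv (internal⇒∉U iv))
    compare (inj₂ (iv , _))   (inj₁ (Uv , _))   = ⊥-elim (true≢false Uv (internal⇒∉U iv))
    compare (inj₂ (_ , ln≡j)) (inj₂ (_ , ln≡k)) = trans (sym ln≡j) ln≡k

  differentTypes⇒≢ : ∀ {j k u v} → hasType G j u ≡ true → hasType G k v ≡ true → j ≢ k → u ≢ v
  differentTypes⇒≢ p q j≢k refl = j≢k (hasType-unique p q)

  differentTypes⇒¬ : ∀ {j k v} → hasType G j v ≡ true → j ≢ k → hasType G k v ≡ false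
  differentTypes⇒¬ p j≢k = ≢true⇒false λ q → j≢k (hasType-unique p q)

  leaf⇒∉U : ∀ {v} → leaf G v ≡ true → inU G v ≡ false
  leaf⇒∉U p = not-true⁻ (∧-trueˡ p)

  leaf⇒¬internal : ∀ {v} → leaf G v ≡ true → internal G v ≡ false
  leaf⇒¬internal {v} p = ∧-falseʳ (not (inU G v)) (not-true (∧-trueʳ p))

  leaf⇒untyped : ∀ k {v} → leaf G v ≡ true → hasType G k v ≡ false
  leaf⇒untyped k p = ∨-false (∧-falseˡ _ (leaf⇒¬internal p)) (∧-falseˡ _ (leaf⇒∉U p))

  typed⇒¬leaf : ∀ {k v} → hasType G k v ≡ true → leaf G v ≡ false
  typed⇒¬leaf {k} p = ≢true⇒false λ l → true≢false p (leaf⇒untyped k l)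

  ¬leaf⇒internal : ∀ {v} → leaf G v ≡ false → inU G v ≡ false → internal G v ≡ true
  ¬leaf⇒internal {v} p q = internal-if {inU G v} {isOne G (degGU G v)} q p
    where internal-if : ∀ {a b} → a ≡ false → not a ∧ b ≡ false → not a ∧ not b ≡ true
          internal-if refl e = not-false e

  leaf-degree : ∀ {w} → leaf G w ≡ true → count (λ c → adj G w c ∧ not (inU G c)) ≡ 1
  leaf-degree {w} p = trans (sym (countB≡count _)) (⌊⌋-true⁻ (_ ≟ℕ 1) (∧-trueʳ p))

  leafNbrs≡count : ∀ v → leafNbrs G v ≡ count (λ w → adj G v w ∧ leaf G w)
  leafNbrs≡count v = countB≡count _

  leaf-neighbour : ∀ {w} → leaf G w ≡ true → Σ (Vtx G) λ p → Adj G w p × inU G p ≡ false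
  leaf-neighbour lw = let p , q = count-pos⁻ _ (≤-reflexive (sym (leaf-degree lw)))
                      in p , ∧-trueˡ q , not-true⁻ (∧-trueʳ q)

  leaf-neighbour∉U : ∀ {w u} → leaf G w ≡ true → Adj G w u → inU G u ≡ false
  leaf-neighbour∉U {w} {u} lw wu = ≢true⇒false λ Uu →
    let p , wp , Up = leaf-neighbour lw
        u≢p : u ≢ p
        u≢p u≡p = true≢false Uu (subst (λ z → inU G z ≡ false) (sym u≡p) Up)
    in triangle-free (adj⇒≢ wu ∘ sym) u≢p (adj⇒≢ wp) (adj-sym wu) wp
                     (adj-sym (inU-adj₂ Uu (adj-sym wu) wp u≢p))

  leaf-neighbour-unique : ∀ {w a b} → leaf G w ≡ true → Adj G w a → Adj G w b → a ≡ b
  leaf-neighbour-unique lw wa wb = count≡1⇒unique (leaf-degree lw)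
    (∧-true wa (not-false (leaf-neighbour∉U lw wa))) (∧-true wb (not-false (leaf-neighbour∉U lw wb)))

  -- Two adjacent leaves would form a K₂ component, whose vertices lie in U.
  leaf-neighbour-¬leaf : ∀ {w a} → leaf G w ≡ true → Adj G w a → leaf G a ≡ false
  leaf-neighbour-¬leaf {w} {a} lw wa = ≢true⇒false λ la → true≢false (inU⁺ w (complete la)) (leaf⇒∉U lw)
    where
    reach⇒w∨a : leaf G a ≡ true → ∀ j c → reach G j w c ≡ true → c ≡ w ⊎ c ≡ a
    reach⇒w∨a la zero    c p = inj₁ (sym (eqB-true⁻ p))
    reach⇒w∨a la (suc j) c p with ∨-true⁻ p
    ... | inj₁ q = reach⇒w∨a la j c q
    ... | inj₂ q with any-tabulate⁻ (λ d → reach G j w d ∧ adj G d c) (λ i → i) q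
    ...   | d , r with reach⇒w∨a la j d (∧-trueˡ r)
    ...     | inj₁ refl = inj₂ (leaf-neighbour-unique lw (∧-trueʳ r) wa)
    ...     | inj₂ refl = inj₁ (leaf-neighbour-unique la (∧-trueʳ r) (adj-sym wa))
    complete : leaf G a ≡ true → ∀ c d → sameComp G w c ≡ true → sameComp G w d ≡ true → c ≢ d → Adj G c d
    complete la c d wc wd c≢d with reach⇒w∨a la (n G) c wc | reach⇒w∨a la (n G) d wd
    ... | inj₁ refl | inj₁ refl = ⊥-elim (c≢d refl)
    ... | inj₁ refl | inj₂ refl = wa
    ... | inj₂ refl | inj₁ refl = adj-sym wa
    ... | inj₂ refl | inj₂ refl = ⊥-elim (c≢d refl)

  internal⇒anotherNeighbour : ∀ {v y} → internal G v ≡ true → Adj G v y → inU G y ≡ false →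
    Σ (Vtx G) λ z → z ≢ y × Adj G v z × inU G z ≡ false
  internal⇒anotherNeighbour {v} {y} iv vy Uy =
    let z , z≢y , q = count≥2⇒∃≢ (≥2 (count-pos y (∧-true vy (not-false Uy))) degree≢1) y
    in z , z≢y , ∧-trueˡ q , not-true⁻ (∧-trueʳ q)
    where
    degree≢1 : count (λ c → adj G v c ∧ not (inU G c)) ≢ 1
    degree≢1 d≡1 = true≢false (⌊⌋-true (_ ≟ℕ 1) (trans (countB≡count _) d≡1)) (not-true⁻ (∧-trueʳ iv))
    ≥2 : ∀ {k} → 1 ≤ k → k ≢ 1 → 2 ≤ k
    ≥2 {suc zero}    _ k≢1 = ⊥-elim (k≢1 refl)
    ≥2 {suc (suc k)} _ _   = s≤s (s≤s z≤n)

  leaf-neighbour-internal : ∀ {w a} → leaf G w ≡ true → Adj G w a → internal G a ≡ true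
  leaf-neighbour-internal lw wa = ¬leaf⇒internal (leaf-neighbour-¬leaf lw wa) (leaf-neighbour∉U lw wa)

  leaf-neighbour-hasLeaf : ∀ {w a} → leaf G w ≡ true → Adj G w a → 1 ≤ leafNbrs G a
  leaf-neighbour-hasLeaf {w} {a} lw wa =
    subst (1 ≤_) (sym (leafNbrs≡count a)) (count-pos w (∧-true (adj-sym wa) lw))

-- Graphs with a unique vertex x of type 2 and no vertex of type ≥ 3

module UniqueType2 (G : Graph) (girth : GirthAtLeast6 G) (x : Vtx G)
  (x-type2 : hasType G 2 x ≡ true) (type2⇒x : ∀ v → hasType G 2 v ≡ true → v ≡ x)
  (no-type≥3 : ∀ k v → 3 ≤ k → hasType G k v ≡ false) where

  open Independence G
  open Components G
  open Girth G girth
  open Types G girth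

  data Class (v : Vtx G) : Set where
    is-leaf  : leaf G v ≡ true → Class v
    is-type0 : hasType G 0 v ≡ true → Class v
    is-type1 : hasType G 1 v ≡ true → Class v
    is-x     : v ≡ x → Class v

  classifyInternal : ∀ {v} → internal G v ≡ true → Class v
  classifyInternal {v} iv = byType (leafNbrs G v) (internal⇒hasType iv)
    where
    byType : ∀ k → hasType G k v ≡ true → Class v
    byType 0                   t = is-type0 t
    byType 1                   t = is-type1 t
    byType 2                   t = is-x (type2⇒x v t)
    byType (suc (suc (suc _))) t = ⊥-elim (true≢false t (no-type≥3 _ v (s≤s (s≤s (s≤s z≤n)))))

  classify : ∀ v → Class v
  classify v = byCases (true-or-false (inU G v)) (true-or-false (leaf G v))
    where
    byCases : inU G v ≡ true ⊎ inU G v ≡ false → leaf G v ≡ true ⊎ leaf G v ≡ false → Class v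
    byCases (inj₁ Uv) _         = is-type0 (inU⇒type0 Uv)
    byCases (inj₂ Uv) (inj₁ lv) = is-leaf lv
    byCases (inj₂ Uv) (inj₂ lv) = classifyInternal (¬leaf⇒internal lv Uv)

  internal-type : ∀ v → v ≢ x → internal G v ≡ true → hasType G 0 v ≡ true ⊎ hasType G 1 v ≡ true
  internal-type v v≢x iv = byClass (classifyInternal iv)
    where
    byClass : Class v → hasType G 0 v ≡ true ⊎ hasType G 1 v ≡ true
    byClass (is-leaf lv)  = ⊥-elim (true≢false iv (leaf⇒¬internal lv))
    byClass (is-type0 t0) = inj₁ t0
    byClass (is-type1 t1) = inj₂ t1
    byClass (is-x v≡x)    = ⊥-elim (v≢x v≡x)

  -- The support vertices, i.e. those adjacent to a leaf.
  support : Vtx G → Bool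
  support v = hasType G 1 v ∨ hasType G 2 v

  support⁻ : ∀ {v} → support v ≡ true → hasType G 1 v ≡ true ⊎ v ≡ x
  support⁻ {v} p = [ inj₁ , inj₂ ∘ type2⇒x v ]′ (∨-true⁻ p)

  type1⇒support : ∀ {v} → hasType G 1 v ≡ true → support v ≡ true
  type1⇒support p = ∨-trueˡ _ p

  support-x : support x ≡ true
  support-x = ∨-trueʳ (hasType G 1 x) x-type2

  x⇒support : ∀ {v} → v ≡ x → support v ≡ true
  x⇒support refl = support-x

  support⇒internal : ∀ {v} → support v ≡ true → internal G v ≡ true
  support⇒internal p = [ proj₁ ∘ positiveType⁻ , (λ { refl → proj₁ (positiveType⁻ x-type2) }) ]′ (support⁻ p)

  support-leafNbrs : ∀ {v} → support v ≡ true → leafNbrs G v ≡ suc (𝟙 (eqB G x v))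
  support-leafNbrs {v} p = [ type1 , isX ]′ (support⁻ p)
    where
    isX : v ≡ x → leafNbrs G v ≡ suc (𝟙 (eqB G x v))
    isX refl = trans (proj₂ (positiveType⁻ x-type2)) (cong (suc ∘ 𝟙) (sym (eqB-refl x)))
    type1 : hasType G 1 v ≡ true → leafNbrs G v ≡ suc (𝟙 (eqB G x v))
    type1 t1 = trans (proj₂ (positiveType⁻ t1)) (cong (suc ∘ 𝟙) (sym (eqB-false (differentTypes⇒≢ x-type2 t1 λ ()))))

  type0⇒¬support : ∀ {v} → hasType G 0 v ≡ true → support v ≡ false
  type0⇒¬support t0 = ∨-false (differentTypes⇒¬ t0 λ ()) (differentTypes⇒¬ t0 λ ())

  leaf⇒¬support : ∀ {v} → leaf G v ≡ true → support v ≡ false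
  leaf⇒¬support l = ∨-false (leaf⇒untyped 1 l) (leaf⇒untyped 2 l)

  leaf-neighbour-support : ∀ {w a} → leaf G w ≡ true → Adj G w a → support a ≡ true
  leaf-neighbour-support {w} {a} lw wa = byClass (classifyInternal ia)
    where
    ia = leaf-neighbour-internal lw wa
    byClass : Class a → support a ≡ true
    byClass (is-leaf la)  = ⊥-elim (true≢false la (leaf-neighbour-¬leaf lw wa))
    byClass (is-type0 t0) = ⊥-elim (1+n≰n (subst (1 ≤_) (sym (hasType-unique t0 (internal⇒hasType ia)))
                                                      (leaf-neighbour-hasLeaf lw wa)))
    byClass (is-type1 t1) = type1⇒support t1
    byClass (is-x a≡x)    = x⇒support a≡x

  support⇒leaf : ∀ {v} → support v ≡ true → Σ (Vtx G) λ w → Adj G v w × leaf G w ≡ true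
  support⇒leaf {v} sv =
    let w , q = count-pos⁻ (λ w → adj G v w ∧ leaf G w)
                  (subst (1 ≤_) (leafNbrs≡count v) (subst (1 ≤_) (sym (support-leafNbrs sv)) (s≤s z≤n)))
    in w , ∧-trueˡ {adj G v w} q , ∧-trueʳ {adj G v w} q

  type0-¬adj-leaf : ∀ {v w} → hasType G 0 v ≡ true → Adj G v w → leaf G w ≡ false
  type0-¬adj-leaf t0 vw = ≢true⇒false λ lw → true≢false (leaf-neighbour-support lw (adj-sym vw)) (type0⇒¬support t0)

  supportsOf-leaf : ∀ {w} → leaf G w ≡ true → count (λ v → support v ∧ adj G v w) ≡ 1
  supportsOf-leaf {w} lw = trans (count-cong λ v → sym (true⇔true⇒≡ (to v) (from v))) (leaf-degree lw)
    where
    to : ∀ v → adj G w v ∧ not (inU G v) ≡ true → support v ∧ adj G v w ≡ true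
    to v q = ∧-true (leaf-neighbour-support lw (∧-trueˡ q)) (adj-sym (∧-trueˡ q))
    from : ∀ v → support v ∧ adj G v w ≡ true → adj G w v ∧ not (inU G v) ≡ true
    from v q = ∧-true (adj-sym (∧-trueʳ q)) (not-false (internal⇒∉U (support⇒internal (∧-trueˡ q))))

  exactlyOneKind : ∀ v → 𝟙 (hasType G 0 v) + 𝟙 (support v) + 𝟙 (leaf G v) ≡ 1
  exactlyOneKind v = byClass (classify v)
    where
    kinds : ∀ {a b c a′ b′ c′} → a ≡ a′ → b ≡ b′ → c ≡ c′ →
            𝟙 a′ + 𝟙 b′ + 𝟙 c′ ≡ 1 → 𝟙 a + 𝟙 b + 𝟙 c ≡ 1
    kinds refl refl refl e = e
    byClass : Class v → 𝟙 (hasType G 0 v) + 𝟙 (support v) + 𝟙 (leaf G v) ≡ 1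
    byClass (is-leaf l)   = kinds (leaf⇒untyped 0 l) (leaf⇒¬support l) l refl
    byClass (is-type0 t0) = kinds t0 (type0⇒¬support t0) (typed⇒¬leaf t0) refl
    byClass (is-type1 t1) = kinds (differentTypes⇒¬ t1 λ ()) (type1⇒support t1) (typed⇒¬leaf t1) refl
    byClass (is-x refl)   = kinds (differentTypes⇒¬ x-type2 λ ()) support-x (typed⇒¬leaf x-type2) refl

  V₀ : Subset (n G)
  V₀ = V G 0

  α₀ : ℕ
  α₀ = αOn G V₀

  type0Part : Subset (n G) → ℕ
  type0Part S = count (λ v → hasType G 0 v ∧ S ! v)

  leafWeight : Subset (n G) → Vtx G → ℕ
  leafWeight S v = count (λ w → adj G v w ∧ (leaf G w ∧ S ! w))

  supportWeight : Subset (n G) → Vtx G → ℕ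
  supportWeight S v = if support v then 𝟙 (S ! v) + leafWeight S v else 0

  leafCapacity : Vtx G → ℕ
  leafCapacity v = if support v then leafNbrs G v else 0

  -- The number of leaves, each counted at its support.
  leafTotal : ℕ
  leafTotal = sum leafCapacity

  leaves-by-support : ∀ S → count (λ w → leaf G w ∧ S ! w) ≡ sum (λ v → if support v then leafWeight S v else 0)
  leaves-by-support S = begin
    sum (λ w → 𝟙 (leaf G w ∧ S ! w))            ≡⟨ sum-cong-≗ atLeaf ⟩
    sum (λ w → sum (λ v → incidence v w))       ≡⟨ ∑-comm (λ w v → incidence v w) ⟩
    sum (λ v → sum (λ w → incidence v w))       ≡⟨ sum-cong-≗ atSupport ⟩
    sum (λ v → if support v then leafWeight S v else 0) ∎
    where
    open ≡-Reasoning
    incidence : Vtx G → Vtx G → ℕ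
    incidence v w = 𝟙 ((support v ∧ adj G v w) ∧ (leaf G w ∧ S ! w))
    atLeaf : ∀ w → 𝟙 (leaf G w ∧ S ! w) ≡ sum (λ v → incidence v w)
    atLeaf w = sym (trans (sum-𝟙-∧ (λ v → support v ∧ adj G v w) (leaf G w ∧ S ! w)) (byCase _ refl))
      where
      byCase : ∀ b → leaf G w ∧ S ! w ≡ b → (if b then count (λ v → support v ∧ adj G v w) else 0) ≡ 𝟙 b
      byCase true  e = supportsOf-leaf (∧-trueˡ e)
      byCase false _ = refl
    atSupport : ∀ v → sum (λ w → incidence v w) ≡ (if support v then leafWeight S v else 0)
    atSupport v = onSupport (support v)
      where
      onSupport : ∀ b → sum (λ w → 𝟙 ((b ∧ adj G v w) ∧ (leaf G w ∧ S ! w))) ≡ (if b then leafWeight S v else 0)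
      onSupport true  = refl
      onSupport false = sum-replicate-zero (n G)

  size-by-kind : ∀ S → ∣ S ∣ ≡ type0Part S + sum (supportWeight S)
  size-by-kind S = begin
    ∣ S ∣                                        ≡⟨ ∣∣≡count S ⟩
    sum (λ v → 𝟙 (S ! v))                        ≡⟨ sum-cong-≗ byKind ⟩
    sum (λ v → inType0 v + inSupport v + inLeaf v) ≡⟨ ∑-distrib-+ (λ v → inType0 v + inSupport v) inLeaf ⟩
    sum (λ v → inType0 v + inSupport v) + sum inLeaf
      ≡⟨ cong₂ _+_ (∑-distrib-+ inType0 inSupport) (leaves-by-support S) ⟩
    sum inType0 + sum inSupport + sum atLeaves    ≡⟨ +-assoc (sum inType0) (sum inSupport) (sum atLeaves) ⟩
    sum inType0 + (sum inSupport + sum atLeaves)  ≡⟨ cong (sum inType0 +_) (∑-distrib-+ inSupport atLeaves) ⟨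
    sum inType0 + sum (λ v → inSupport v + atLeaves v) ≡⟨ cong (sum inType0 +_) (sum-cong-≗ atSupport) ⟩
    type0Part S + sum (supportWeight S)          ∎
    where
    open ≡-Reasoning
    inType0 inSupport inLeaf atLeaves : Vtx G → ℕ
    inType0 v   = 𝟙 (hasType G 0 v ∧ S ! v)
    inSupport v = 𝟙 (support v ∧ S ! v)
    inLeaf v    = 𝟙 (leaf G v ∧ S ! v)
    atLeaves v  = if support v then leafWeight S v else 0
    byKind : ∀ v → 𝟙 (S ! v) ≡ inType0 v + inSupport v + inLeaf v
    byKind v = 𝟙-partition (hasType G 0 v) (support v) (leaf G v) (S ! v) (exactlyOneKind v)
    atSupport : ∀ v → inSupport v + atLeaves v ≡ supportWeight S v
    atSupport v = onSupport (support v)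
      where
      onSupport : ∀ b → 𝟙 (b ∧ S ! v) + (if b then leafWeight S v else 0) ≡ (if b then 𝟙 (S ! v) + leafWeight S v else 0)
      onSupport true  = refl
      onSupport false = refl

  leafWeight-≤ : ∀ S v → leafWeight S v ≤ leafNbrs G v
  leafWeight-≤ S v = subst (leafWeight S v ≤_) (sym (leafNbrs≡count v))
    (count-mono λ w → ∧-∧-true⇒∧ (adj G v w) (leaf G w))

  leafWeight-member : ∀ S {v} → Independent S → S ! v ≡ true → leafWeight S v ≡ 0
  leafWeight-member S {v} indS Sv = sum-zero λ w → cong 𝟙 (byCase w (true-or-false (S ! w)))
    where
    byCase : ∀ w → S ! w ≡ true ⊎ S ! w ≡ false → adj G v w ∧ (leaf G w ∧ S ! w) ≡ false
    byCase w (inj₁ Sw) = ∧-falseˡ _ (indS v w Sv Sw)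
    byCase w (inj₂ Sw) = ∧-falseʳ (adj G v w) (∧-falseʳ (leaf G w) Sw)

  -- A leaf outside a dominating set must be dominated by its only neighbour.
  leafWeight-nonmember : ∀ S {v} → Dominates S (allV G) → S ! v ≡ false → leafWeight S v ≡ leafNbrs G v
  leafWeight-nonmember S {v} domS Sv =
    trans (count-cong λ w → true⇔true⇒≡ (∧-∧-true⇒∧ (adj G v w) (leaf G w)) (keep w)) (sym (leafNbrs≡count v))
    where
    keep : ∀ w → adj G v w ∧ leaf G w ≡ true → adj G v w ∧ (leaf G w ∧ S ! w) ≡ true
    keep w q = ∧-true vw (∧-true lw (≢false⇒true λ Sw →
      let u , Su , uw = domS w (lookup-allV w) Sw
      in true≢false (subst (λ z → S ! z ≡ true) (leaf-neighbour-unique lw (adj-sym uw) (adj-sym vw)) Su) Sv))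
      where vw = ∧-trueˡ {adj G v w} q
            lw = ∧-trueʳ {adj G v w} q

  supportWeight-≤ : ∀ S → Independent S → ∀ v → supportWeight S v ≤ leafCapacity v
  supportWeight-≤ S indS v = if-mono-≤ (support v) onSupport
    where
    onSupport : support v ≡ true → 𝟙 (S ! v) + leafWeight S v ≤ leafNbrs G v
    onSupport sv = [ member , nonmember ]′ (true-or-false (S ! v))
      where
      member : S ! v ≡ true → 𝟙 (S ! v) + leafWeight S v ≤ leafNbrs G v
      member Sv = subst₂ _≤_ (sym (cong₂ (λ b l → 𝟙 b + l) Sv (leafWeight-member S indS Sv)))
                            (sym (support-leafNbrs sv)) (s≤s z≤n)
      nonmember : S ! v ≡ false → 𝟙 (S ! v) + leafWeight S v ≤ leafNbrs G v
      nonmember Sv = subst (λ b → 𝟙 b + leafWeight S v ≤ leafNbrs G v) (sym Sv) (leafWeight-≤ S v)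

  supportWeight-maximal : ∀ S → Independent S → Dominates S (allV G) →
    ∀ v → supportWeight S v + 𝟙 (eqB G x v ∧ S ! v) ≡ leafCapacity v
  supportWeight-maximal S indS domS v = if-+𝟙 (support v) onSupport offSupport
    where
    open ≡-Reasoning
    offSupport : support v ≡ false → eqB G x v ∧ S ! v ≡ false
    offSupport sv = ∧-falseˡ _ (eqB-false λ x≡v → true≢false (x⇒support (sym x≡v)) sv)
    onSupport : support v ≡ true → 𝟙 (S ! v) + leafWeight S v + 𝟙 (eqB G x v ∧ S ! v) ≡ leafNbrs G v
    onSupport sv = [ member , nonmember ]′ (true-or-false (S ! v))
      where
      member : S ! v ≡ true → 𝟙 (S ! v) + leafWeight S v + 𝟙 (eqB G x v ∧ S ! v) ≡ leafNbrs G v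
      member Sv = begin
        𝟙 (S ! v) + leafWeight S v + 𝟙 (eqB G x v ∧ S ! v)
          ≡⟨ cong₂ (λ b l → 𝟙 b + l + 𝟙 (eqB G x v ∧ b)) Sv (leafWeight-member S indS Sv) ⟩
        suc (𝟙 (eqB G x v ∧ true))  ≡⟨ cong (suc ∘ 𝟙) (∧-identityʳ _) ⟩
        suc (𝟙 (eqB G x v))         ≡⟨ sym (support-leafNbrs sv) ⟩
        leafNbrs G v                ∎
      nonmember : S ! v ≡ false → 𝟙 (S ! v) + leafWeight S v + 𝟙 (eqB G x v ∧ S ! v) ≡ leafNbrs G v
      nonmember Sv = begin
        𝟙 (S ! v) + leafWeight S v + 𝟙 (eqB G x v ∧ S ! v)
          ≡⟨ cong₂ (λ b l → 𝟙 b + l + 𝟙 (eqB G x v ∧ b)) Sv (leafWeight-nonmember S domS Sv) ⟩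
        leafNbrs G v + 𝟙 (eqB G x v ∧ false) ≡⟨ cong (λ b → leafNbrs G v + 𝟙 b) (∧-zeroʳ _) ⟩
        leafNbrs G v + 0                     ≡⟨ +-identityʳ _ ⟩
        leafNbrs G v                         ∎

  type0Part-≤ : ∀ S → Independent S → type0Part S ≤ α₀
  type0Part-≤ S indS = subst (_≤ α₀) (∣tabulate∣≡count type0∩S)
    (≤-αOn V₀ (tabulate type0∩S)
      (λ v q → trans (lookup∘tabulate (hasType G 0) v) (∧-trueˡ (member v q)))
      (λ u v p q → indS u v (∧-trueʳ (member u p)) (∧-trueʳ (member v q))))
    where
    type0∩S : Vtx G → Bool
    type0∩S v = hasType G 0 v ∧ S ! v
    member : ∀ v → tabulate type0∩S ! v ≡ true → type0∩S v ≡ true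
    member v = trans (sym (lookup∘tabulate type0∩S v))

  independent-size-≤ : ∀ S → Independent S → ∣ S ∣ ≤ α₀ + leafTotal
  independent-size-≤ S indS = subst (_≤ α₀ + leafTotal) (sym (size-by-kind S))
    (+-mono-≤ (type0Part-≤ S indS) (sum-mono-≤ (supportWeight-≤ S indS)))

  maximal-size : ∀ S → Independent S → Dominates S (allV G) → ∣ S ∣ + 𝟙 (S ! x) ≡ type0Part S + leafTotal
  maximal-size S indS domS = begin
    ∣ S ∣ + 𝟙 (S ! x)                                    ≡⟨ cong₂ _+_ (size-by-kind S) x-term ⟩
    type0Part S + sum (supportWeight S) + count isX∩S     ≡⟨ +-assoc (type0Part S) _ _ ⟩
    type0Part S + (sum (supportWeight S) + count isX∩S)
      ≡⟨ cong (type0Part S +_) (∑-distrib-+ (supportWeight S) (𝟙 ∘ isX∩S)) ⟨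
    type0Part S + sum (λ v → supportWeight S v + 𝟙 (isX∩S v))
      ≡⟨ cong (type0Part S +_) (sum-cong-≗ (supportWeight-maximal S indS domS)) ⟩
    type0Part S + leafTotal                               ∎
    where
    open ≡-Reasoning
    isX∩S : Vtx G → Bool
    isX∩S v = eqB G x v ∧ S ! v
    x-term : 𝟙 (S ! x) ≡ count isX∩S
    x-term = sym (trans (count-single isX∩S x (λ v v≢x → ∧-falseˡ _ (eqB-false (v≢x ∘ sym))))
                        (cong (λ b → 𝟙 (b ∧ S ! x)) (eqB-refl x)))

  G₀-N : Subset (n G) → Subset (n G)
  G₀-N I = minusNbh G V₀ I

  G₀-N⁻ : ∀ I {v} → G₀-N I ! v ≡ true → hasType G 0 v ≡ true × inNbhB G I v ≡ false
  G₀-N⁻ I {v} p = let V₀v , I↛v = lookup-minusNbh⁻ V₀ I v p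
                  in trans (sym (lookup∘tabulate (hasType G 0) v)) V₀v , I↛v

  G₀-N⁺ : ∀ I {v} → hasType G 0 v ≡ true → inNbhB G I v ≡ false → G₀-N I ! v ≡ true
  G₀-N⁺ I {v} t0 = lookup-minusNbh⁺ V₀ I v (trans (lookup∘tabulate (hasType G 0) v) t0)

  G₀-N⊆V₀ : ∀ I → G₀-N I ⊆ V₀
  G₀-N⊆V₀ I v p = trans (lookup∘tabulate (hasType G 0) v) (proj₁ (G₀-N⁻ I p))

  G₀-N-cong : ∀ I J → (∀ v → hasType G 0 v ≡ true → inNbhB G I v ≡ inNbhB G J v) → G₀-N I ≡ G₀-N J
  G₀-N-cong I J same = tabulate-cong λ v → byCase v (true-or-false (hasType G 0 v))
    where
    byCase : ∀ v → hasType G 0 v ≡ true ⊎ hasType G 0 v ≡ false →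
             V₀ ! v ∧ not (inNbhB G I v) ≡ V₀ ! v ∧ not (inNbhB G J v)
    byCase v (inj₁ t0) = cong (λ b → V₀ ! v ∧ not b) (same v t0)
    byCase v (inj₂ t0) = let V₀v = trans (lookup∘tabulate (hasType G 0) v) t0
                         in trans (∧-falseˡ _ V₀v) (sym (∧-falseˡ _ V₀v))

  G₀-N-∅ : G₀-N ∅ ≡ V₀
  G₀-N-∅ = tabulate-cong λ v →
    trans (cong (λ b → V₀ ! v ∧ not b) (inNbhB-∅ v)) (trans (∧-identityʳ _) (lookup∘tabulate (hasType G 0) v))

  iOn-G₀-N-≤ : ∀ I → iOn G (G₀-N I) ≤ α₀
  iOn-G₀-N-≤ I = let T , maxT , ∣T∣≡i = iOn-attained (G₀-N I)
                     T⊆ , indT , _ = maxIndepInB⁻ (G₀-N I) T maxT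
                 in subst (_≤ α₀) ∣T∣≡i (≤-αOn V₀ T (λ v Tv → G₀-N⊆V₀ I v (T⊆ v Tv)) indT)

  module Lift (I : Subset (n G)) (I⊆support : ∀ v → I ! v ≡ true → support v ≡ true) (indI : Independent I)
              (T : Subset (n G)) (maxT : maxIndepInB G (G₀-N I) T ≡ true) where

    private
      T⊆ = proj₁ (maxIndepInB⁻ (G₀-N I) T maxT)
      indT = proj₁ (proj₂ (maxIndepInB⁻ (G₀-N I) T maxT))
      domT = proj₂ (proj₂ (maxIndepInB⁻ (G₀-N I) T maxT))

      T⁻ : ∀ {v} → T ! v ≡ true → hasType G 0 v ≡ true × inNbhB G I v ≡ false
      T⁻ Tv = G₀-N⁻ I (T⊆ _ Tv)

      member : Vtx G → Bool
      member v = I ! v ∨ T ! v ∨ (leaf G v ∧ not (inNbhB G I v))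

    S : Subset (n G)
    S = tabulate member

    data Member (v : Vtx G) : Set where
      fromI    : I ! v ≡ true → Member v
      fromT    : T ! v ≡ true → Member v
      freeLeaf : leaf G v ≡ true → inNbhB G I v ≡ false → Member v

    S⁻ : ∀ {v} → S ! v ≡ true → Member v
    S⁻ {v} p = [ fromI , [ fromT , (λ r → freeLeaf (∧-trueˡ r) (not-true⁻ (∧-trueʳ r))) ]′ ∘ ∨-true⁻ ]′
                 (∨-true⁻ (trans (sym (lookup∘tabulate member v)) p))

    S⁺ : ∀ {v} → Member v → S ! v ≡ true
    S⁺ {v} m = trans (lookup∘tabulate member v) (byMember m)
      where
      byMember : Member v → member v ≡ true
      byMember (fromI Iv)        = ∨-trueˡ _ Iv
      byMember (fromT Tv)        = ∨-trueʳ (I ! v) (∨-trueˡ _ Tv)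
      byMember (freeLeaf lv I↛v) = ∨-trueʳ (I ! v) (∨-trueʳ (T ! v) (∧-true lv (not-false I↛v)))

    private
      I-¬adj : ∀ {u v} → I ! u ≡ true → inNbhB G I v ≡ false → adj G u v ≡ false
      I-¬adj Iu I↛v = ≢true⇒false λ uv → true≢false (inNbhB-true I Iu uv) I↛v

      type0-¬adj-leafᶠ : ∀ {u v} → hasType G 0 u ≡ true → leaf G v ≡ true → adj G u v ≡ false
      type0-¬adj-leafᶠ t0 lv = ≢true⇒false λ uv → true≢false lv (type0-¬adj-leaf t0 uv)

      leaf-¬adj-leaf : ∀ {u v} → leaf G u ≡ true → leaf G v ≡ true → adj G u v ≡ false
      leaf-¬adj-leaf lu lv = ≢true⇒false λ uv → true≢false lv (leaf-neighbour-¬leaf lu uv)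

    independent : Independent S
    independent u v Su Sv = byMember (S⁻ Su) (S⁻ Sv)
      where
      byMember : Member u → Member v → adj G u v ≡ false
      byMember (fromI Iu)       (fromI Iv)       = indI u v Iu Iv
      byMember (fromI Iu)       (fromT Tv)       = I-¬adj Iu (proj₂ (T⁻ Tv))
      byMember (fromI Iu)       (freeLeaf _ I↛v) = I-¬adj Iu I↛v
      byMember (fromT Tu)       (fromI Iv)       = adj-symᶠ (I-¬adj Iv (proj₂ (T⁻ Tu)))
      byMember (fromT Tu)       (fromT Tv)       = indT u v Tu Tv
      byMember (fromT Tu)       (freeLeaf lv _)  = type0-¬adj-leafᶠ (proj₁ (T⁻ Tu)) lv
      byMember (freeLeaf _ I↛u) (fromI Iv)       = adj-symᶠ (I-¬adj Iv I↛u)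
      byMember (freeLeaf lu _)  (fromT Tv)       = adj-symᶠ (type0-¬adj-leafᶠ (proj₁ (T⁻ Tv)) lu)
      byMember (freeLeaf lu _)  (freeLeaf lv _)  = leaf-¬adj-leaf lu lv

    dominates : Dominates S (allV G)
    dominates v _ Sv = byClass (classify v)
      where
      Dominated : Set
      Dominated = Σ (Vtx G) λ u → S ! u ≡ true × Adj G u v
      I∌v : I ! v ≡ false
      I∌v = ≢true⇒false λ Iv → true≢false (S⁺ (fromI Iv)) Sv
      byI : inNbhB G I v ≡ true → Dominated
      byI I→v = let u , Iu , uv = inNbhB-true⁻ I v I→v in u , S⁺ (fromI Iu) , uv
      -- A support outside S is dominated by one of its leaves, which I cannot dominate.
      byLeaf : support v ≡ true → Dominated
      byLeaf sv = w , S⁺ (freeLeaf lw I↛w) , adj-sym vw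
        where
        leafOfV : Σ (Vtx G) λ w → Adj G v w × leaf G w ≡ true
        leafOfV = support⇒leaf sv
        w : Vtx G
        w = proj₁ leafOfV
        vw : Adj G v w
        vw = proj₁ (proj₂ leafOfV)
        lw : leaf G w ≡ true
        lw = proj₂ (proj₂ leafOfV)
        I↛w : inNbhB G I w ≡ false
        I↛w = inNbhB-false I w λ u Iu → ≢true⇒false λ uw →
          true≢false (subst (λ z → I ! z ≡ true) (leaf-neighbour-unique lw (adj-sym uw) (adj-sym vw)) Iu) I∌v
      byClass : Class v → Dominated
      byClass (is-leaf lv) = [ byI , (λ I↛v → ⊥-elim (true≢false (S⁺ (freeLeaf lv I↛v)) Sv)) ]′
                               (true-or-false (inNbhB G I v))
      byClass (is-type0 t0) = [ byI , byT ]′ (true-or-false (inNbhB G I v))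
        where
        byT : inNbhB G I v ≡ false → Dominated
        byT I↛v = let u , Tu , uv = domT v (G₀-N⁺ I t0 I↛v) (≢true⇒false λ Tv → true≢false (S⁺ (fromT Tv)) Sv)
                  in u , S⁺ (fromT Tu) , uv
      byClass (is-type1 t1) = byLeaf (type1⇒support t1)
      byClass (is-x v≡x)    = byLeaf (x⇒support v≡x)

    maximal : maxIndepInB G (allV G) S ≡ true
    maximal = maxIndepInB⁺ (allV G) S (λ v _ → lookup-allV v) independent dominates

    size : ∣ S ∣ + 𝟙 (I ! x) ≡ ∣ T ∣ + leafTotal
    size = begin
      ∣ S ∣ + 𝟙 (I ! x)        ≡⟨ cong (λ b → ∣ S ∣ + 𝟙 b) (sym S∋x⇔I∋x) ⟩
      ∣ S ∣ + 𝟙 (S ! x)        ≡⟨ maximal-size S independent dominates ⟩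
      type0Part S + leafTotal  ≡⟨ cong (_+ leafTotal) (trans (count-cong type0∩S≡T) (sym (∣∣≡count T))) ⟩
      ∣ T ∣ + leafTotal        ∎
      where
      open ≡-Reasoning
      S∋x⇔I∋x : S ! x ≡ I ! x
      S∋x⇔I∋x = true⇔true⇒≡ (λ Sx → byMember (S⁻ Sx)) (S⁺ ∘ fromI)
        where
        byMember : Member x → I ! x ≡ true
        byMember (fromI Ix)      = Ix
        byMember (fromT Tx)      = ⊥-elim (true≢false support-x (type0⇒¬support (proj₁ (T⁻ Tx))))
        byMember (freeLeaf lx _) = ⊥-elim (true≢false support-x (leaf⇒¬support lx))
      type0∩S≡T : ∀ v → hasType G 0 v ∧ S ! v ≡ T ! v
      type0∩S≡T v = true⇔true⇒≡ (λ q → byMember (∧-trueˡ q) (S⁻ (∧-trueʳ {hasType G 0 v} q)))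
                                (λ Tv → ∧-true (proj₁ (T⁻ Tv)) (S⁺ (fromT Tv)))
        where
        byMember : hasType G 0 v ≡ true → Member v → T ! v ≡ true
        byMember t0 (fromI Iv)      = ⊥-elim (true≢false (I⊆support v Iv) (type0⇒¬support t0))
        byMember t0 (fromT Tv)      = Tv
        byMember t0 (freeLeaf lv _) = ⊥-elim (true≢false t0 (leaf⇒untyped 0 lv))

  α-decomposition : αOn G (allV G) ≡ α₀ + leafTotal
  α-decomposition = ≤-antisym upper lower
    where
    upper : αOn G (allV G) ≤ α₀ + leafTotal
    upper = let open LargestExtension (maximumIndependent (allV G))
            in ≤-trans (αOn≤maximumIndependent (allV G)) (independent-size-≤ set independent)
    open LargestExtension (maximumIndependent (G₀-N ∅)) using (set; maximal)
    module L = Lift ∅ (λ v ∅v → ⊥-elim (true≢false ∅v (lookup-∅ v))) ∅-independent set maximal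
    lower : α₀ + leafTotal ≤ αOn G (allV G)
    lower = begin
      α₀ + leafTotal            ≤⟨ +-monoˡ-≤ leafTotal α₀≤∣set∣ ⟩
      ∣ set ∣ + leafTotal       ≡⟨ sym L.size ⟩
      ∣ L.S ∣ + 𝟙 (∅ {n G} ! x) ≡⟨ cong (λ b → ∣ L.S ∣ + 𝟙 b) (lookup-∅ x) ⟩
      ∣ L.S ∣ + 0               ≡⟨ +-identityʳ _ ⟩
      ∣ L.S ∣                   ≤⟨ ≤-αOn (allV G) L.S (λ v _ → lookup-allV v) L.independent ⟩
      αOn G (allV G)            ∎
      where
      open ≤-Reasoning
      α₀≤∣set∣ : α₀ ≤ ∣ set ∣
      α₀≤∣set∣ = subst (λ H → αOn G H ≤ ∣ set ∣) G₀-N-∅ (αOn≤maximumIndependent (G₀-N ∅))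

  module WithX (I : Subset (n G)) where

    J : Subset (n G)
    J = I ∪ ⁅ x ⁆

    J⁻ : ∀ {v} → J ! v ≡ true → I ! v ≡ true ⊎ v ≡ x
    J⁻ = lookup-∪⁅⁆⁻ I

    J∋x : J ! x ≡ true
    J∋x = lookup-∪⁅⁆-new I x

    J⊆support : (∀ v → I ! v ≡ true → support v ≡ true) → ∀ v → J ! v ≡ true → support v ≡ true
    J⊆support I⊆support v Jv = [ I⊆support v , x⇒support ]′ (J⁻ Jv)

    J-independent : Independent I → (∀ v → I ! v ≡ true → adj G x v ≡ false) → Independent J
    J-independent indI x↛I u v Ju Jv = byCases (J⁻ Ju) (J⁻ Jv)
      where
      byCases : I ! u ≡ true ⊎ u ≡ x → I ! v ≡ true ⊎ v ≡ x → adj G u v ≡ false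
      byCases (inj₁ Iu)   (inj₁ Iv)   = indI u v Iu Iv
      byCases (inj₁ Iu)   (inj₂ refl) = adj-symᶠ (x↛I u Iu)
      byCases (inj₂ refl) (inj₁ Iv)   = x↛I v Iv
      byCases (inj₂ refl) (inj₂ refl) = irrefl G x

    G₀-N-J : (∀ v → Adj G x v → hasType G 0 v ≡ false) → G₀-N J ≡ G₀-N I
    G₀-N-J x↛V₀ = G₀-N-cong J I λ v t0 → true⇔true⇒≡ (J→v v t0) (I→v v)
      where
      J→v : ∀ v → hasType G 0 v ≡ true → inNbhB G J v ≡ true → inNbhB G I v ≡ true
      J→v v t0 p = let u , Ju , uv = inNbhB-true⁻ J v p
                   in [ (λ Iu → inNbhB-true I Iu uv)
                      , (λ u≡x → ⊥-elim (true≢false t0 (x↛V₀ v (subst (λ z → Adj G z v) u≡x uv)))) ]′ (J⁻ Ju)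
      I→v : ∀ v → inNbhB G I v ≡ true → inNbhB G J v ≡ true
      I→v v p = let u , Iu , uv = inNbhB-true⁻ I v p in inNbhB-true J (lookup-∪⁅⁆-old I x Iu) uv

  module Forward (awc : AlmostWellCovered G) where

    lift-bound : ∀ I → (∀ v → I ! v ≡ true → support v ≡ true) → Independent I →
      ∀ T → maxIndepInB G (G₀-N I) T ≡ true → α₀ + 𝟙 (I ! x) ≤ suc ∣ T ∣
    lift-bound I I⊆support indI T maxT = +-cancelʳ-≤ leafTotal (α₀ + k) (suc ∣ T ∣) (begin
      α₀ + k + leafTotal       ≡⟨ xy∙z≈xz∙y α₀ k leafTotal ⟩
      α₀ + leafTotal + k       ≡⟨ cong (_+ k) (trans (sym α-decomposition) awc) ⟩
      suc (iOn G (allV G)) + k ≤⟨ +-monoˡ-≤ k (s≤s (iOn-≤ (allV G) L.S L.maximal)) ⟩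
      suc ∣ L.S ∣ + k          ≡⟨ cong suc L.size ⟩
      suc ∣ T ∣ + leafTotal    ∎)
      where
      open ≤-Reasoning
      module L = Lift I I⊆support indI T maxT
      k = 𝟙 (I ! x)

    lift-bound-iOn : ∀ I → (∀ v → I ! v ≡ true → support v ≡ true) → Independent I →
      α₀ + 𝟙 (I ! x) ≤ suc (iOn G (G₀-N I))
    lift-bound-iOn I I⊆support indI =
      let T , maxT , ∣T∣≡i = iOn-attained (G₀-N I)
      in subst (λ i → α₀ + 𝟙 (I ! x) ≤ suc i) ∣T∣≡i (lift-bound I I⊆support indI T maxT)

    -- If x had a type-0 neighbour y, then I′ = {x} ∪ (type-1 vertices near y) and a largest independent
    -- set M of G₀ − N(I′) containing D (the vertices two steps from y) could be enlarged by y.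
    module Type0NeighbourOfX (y : Vtx G) (xy : Adj G x y) (y-type0 : hasType G 0 y ≡ true) where

      data NearY (j : Vtx G) : Set where
        adjacent : Adj G y j → NearY j
        viaType0 : ∀ {w} → hasType G 0 w ≡ true → Adj G y w → Adj G w j → NearY j

      private
        type0NbrOfY : Vtx G → Bool
        type0NbrOfY w = hasType G 0 w ∧ adj G y w
        W : Subset (n G)
        W = tabulate type0NbrOfY
        inI′ : Vtx G → Bool
        inI′ v = eqB G x v ∨ (hasType G 1 v ∧ (adj G y v ∨ inNbhB G W v))

      I′ : Subset (n G)
      I′ = tabulate inI′

      I′⁻ : ∀ {v} → I′ ! v ≡ true → v ≡ x ⊎ (hasType G 1 v ≡ true × NearY v)
      I′⁻ {v} p = [ (λ q → inj₁ (sym (eqB-true⁻ q)))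
                  , (λ q → inj₂ (∧-trueˡ q , [ adjacent , viaW ]′ (∨-true⁻ (∧-trueʳ q)))) ]′
                    (∨-true⁻ (trans (sym (lookup∘tabulate inI′ v)) p))
        where
        viaW : inNbhB G W v ≡ true → NearY v
        viaW r = let w , Ww , wv = inNbhB-true⁻ W v r
                     q = trans (sym (lookup∘tabulate type0NbrOfY w)) Ww
                 in viaType0 (∧-trueˡ {hasType G 0 w} q) (∧-trueʳ {hasType G 0 w} q) wv

      I′∋x : I′ ! x ≡ true
      I′∋x = trans (lookup∘tabulate inI′ x) (∨-trueˡ _ (eqB-refl x))

      I′-via : ∀ {v w} → hasType G 1 v ≡ true → hasType G 0 w ≡ true → Adj G y w → Adj G w v → I′ ! v ≡ true
      I′-via {v} {w} t1 w0 yw wv = trans (lookup∘tabulate inI′ v) (∨-trueʳ (eqB G x v) (∧-true t1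
        (∨-trueʳ (adj G y v) (inNbhB-true W (trans (lookup∘tabulate type0NbrOfY w) (∧-true w0 yw)) wv))))

      I′⊆support : ∀ v → I′ ! v ≡ true → support v ≡ true
      I′⊆support v p = [ x⇒support , type1⇒support ∘ proj₁ ]′ (I′⁻ p)

      x-¬adj-near : ∀ {j} → hasType G 1 j ≡ true → NearY j → Adj G x j → ⊥
      x-¬adj-near t1 (adjacent yj) xj =
        triangle-free (adj⇒≢ xy) (differentTypes⇒≢ x-type2 t1 λ ()) (adj⇒≢ yj) xy yj (adj-sym xj)
      x-¬adj-near t1 (viaType0 w0 yw wj) xj =
        square-free (adj⇒≢ xy) (differentTypes⇒≢ x-type2 w0 λ ()) (differentTypes⇒≢ x-type2 t1 λ ())
                    (adj⇒≢ yw) (differentTypes⇒≢ y-type0 t1 λ ()) (differentTypes⇒≢ w0 t1 λ ())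
                    xy yw wj (adj-sym xj)

      adjacent-¬adj-via : ∀ {j₁ j₂ w} → hasType G 1 j₁ ≡ true → hasType G 1 j₂ ≡ true → Adj G y j₁ →
        hasType G 0 w ≡ true → Adj G y w → Adj G w j₂ → Adj G j₁ j₂ → ⊥
      adjacent-¬adj-via t₁ t₂ yj₁ w0 yw wj₂ j₁j₂ =
        square-free (adj⇒≢ yj₁) (differentTypes⇒≢ y-type0 t₂ λ ()) (adj⇒≢ yw) (adj⇒≢ j₁j₂)
                    (differentTypes⇒≢ t₁ w0 λ ()) (differentTypes⇒≢ t₂ w0 λ ())
                    yj₁ j₁j₂ (adj-sym wj₂) (adj-sym yw)

      near-¬adj-near : ∀ {j₁ j₂} → hasType G 1 j₁ ≡ true → hasType G 1 j₂ ≡ true →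
        NearY j₁ → NearY j₂ → Adj G j₁ j₂ → ⊥
      near-¬adj-near t₁ t₂ (adjacent yj₁) (adjacent yj₂) j₁j₂ =
        triangle-free (adj⇒≢ yj₁) (adj⇒≢ yj₂) (adj⇒≢ j₁j₂) yj₁ j₁j₂ (adj-sym yj₂)
      near-¬adj-near t₁ t₂ (adjacent yj₁) (viaType0 w0 yw wj₂) j₁j₂ =
        adjacent-¬adj-via t₁ t₂ yj₁ w0 yw wj₂ j₁j₂
      near-¬adj-near t₁ t₂ (viaType0 w0 yw wj₁) (adjacent yj₂) j₁j₂ =
        adjacent-¬adj-via t₂ t₁ yj₂ w0 yw wj₁ (adj-sym j₁j₂)
      near-¬adj-near t₁ t₂ (viaType0 {w₁} w₁0 yw₁ w₁j₁) (viaType0 {w₂} w₂0 yw₂ w₂j₂) j₁j₂ =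
        byEq (w₁ Finₚ.≟ w₂)
        where
        byEq : Dec (w₁ ≡ w₂) → ⊥
        byEq (yes refl) =
          triangle-free (adj⇒≢ w₁j₁) (adj⇒≢ w₂j₂) (adj⇒≢ j₁j₂) w₁j₁ j₁j₂ (adj-sym w₂j₂)
        byEq (no w₁≢w₂) =
          pentagon-free (adj⇒≢ yw₁) (differentTypes⇒≢ y-type0 t₁ λ ()) (differentTypes⇒≢ y-type0 t₂ λ ())
                        (adj⇒≢ yw₂)
                        (adj⇒≢ w₁j₁) (differentTypes⇒≢ w₁0 t₂ λ ()) w₁≢w₂
                        (adj⇒≢ j₁j₂) (differentTypes⇒≢ t₁ w₂0 λ ()) (differentTypes⇒≢ t₂ w₂0 λ ())
                        yw₁ w₁j₁ j₁j₂ (adj-sym w₂j₂) (adj-sym yw₂)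

      I′-independent : Independent I′
      I′-independent u v Iu Iv = ≢true⇒false (byCases (I′⁻ Iu) (I′⁻ Iv))
        where
        byCases : u ≡ x ⊎ (hasType G 1 u ≡ true × NearY u) → v ≡ x ⊎ (hasType G 1 v ≡ true × NearY v) → ¬ Adj G u v
        byCases (inj₁ u≡x)       (inj₁ v≡x)       uv = adj⇒≢ uv (trans u≡x (sym v≡x))
        byCases (inj₁ u≡x)       (inj₂ (t , r))   uv = x-¬adj-near t r (subst (λ z → Adj G z v) u≡x uv)
        byCases (inj₂ (t , r))   (inj₁ v≡x)       uv = x-¬adj-near t r (adj-sym (subst (Adj G u) v≡x uv))
        byCases (inj₂ (t₁ , r₁)) (inj₂ (t₂ , r₂)) uv = near-¬adj-near t₁ t₂ r₁ r₂ uv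

      H : Subset (n G)
      H = G₀-N I′

      H∌y : H ! y ≡ false
      H∌y = ≢true⇒false λ Hy → true≢false (inNbhB-true I′ I′∋x xy) (proj₂ (G₀-N⁻ I′ Hy))

      y≢H : ∀ {z} → H ! z ≡ true → y ≢ z
      y≢H Hz refl = true≢false Hz H∌y

      private
        H-nbrOfY : Vtx G → Bool
        H-nbrOfY w = H ! w ∧ adj G y w
        inD : Vtx G → Bool
        inD z = H ! z ∧ inNbhB G (tabulate H-nbrOfY) z

      D : Subset (n G)
      D = tabulate inD

      TwoStepsFromY : Vtx G → Set
      TwoStepsFromY z = H ! z ≡ true × Σ (Vtx G) λ w → H ! w ≡ true × Adj G y w × Adj G w z

      D⁻ : ∀ {z} → D ! z ≡ true → TwoStepsFromY z
      D⁻ {z} p = let q = trans (sym (lookup∘tabulate inD z)) p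
                     w , Ww , wz = inNbhB-true⁻ (tabulate H-nbrOfY) z (∧-trueʳ q)
                     r = trans (sym (lookup∘tabulate H-nbrOfY w)) Ww
                 in ∧-trueˡ q , w , ∧-trueˡ {H ! w} r , ∧-trueʳ {H ! w} r , wz

      D⁺ : ∀ {z w} → H ! z ≡ true → H ! w ≡ true → Adj G y w → Adj G w z → D ! z ≡ true
      D⁺ {z} {w} Hz Hw yw wz = trans (lookup∘tabulate inD z)
        (∧-true Hz (inNbhB-true (tabulate H-nbrOfY) (trans (lookup∘tabulate H-nbrOfY w) (∧-true Hw yw)) wz))

      D⊆H : D ⊆ H
      D⊆H z p = proj₁ (D⁻ p)

      D-independent : Independent D
      D-independent z₁ z₂ p₁ p₂ = ≢true⇒false (fromWitnesses (D⁻ p₁) (D⁻ p₂))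
        where
        fromWitnesses : TwoStepsFromY z₁ → TwoStepsFromY z₂ → ¬ Adj G z₁ z₂
        fromWitnesses (Hz₁ , w₁ , _ , yw₁ , w₁z₁) (Hz₂ , w₂ , _ , yw₂ , w₂z₂) z₁z₂ = byEq (w₁ Finₚ.≟ w₂)
          where
          byEq : Dec (w₁ ≡ w₂) → ⊥
          byEq (yes refl) =
            triangle-free (adj⇒≢ w₁z₁) (adj⇒≢ w₂z₂) (adj⇒≢ z₁z₂) w₁z₁ z₁z₂ (adj-sym w₂z₂)
          byEq (no w₁≢w₂) =
            pentagon-free (adj⇒≢ yw₁) (y≢H Hz₁) (y≢H Hz₂) (adj⇒≢ yw₂) (adj⇒≢ w₁z₁) w₁≢z₂ w₁≢w₂
                          (adj⇒≢ z₁z₂) z₁≢w₂ (adj⇒≢ (adj-sym w₂z₂))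
                          yw₁ w₁z₁ z₁z₂ (adj-sym w₂z₂) (adj-sym yw₂)
            where
            w₁≢z₂ : w₁ ≢ z₂
            w₁≢z₂ refl = triangle-free (adj⇒≢ yw₂) (adj⇒≢ yw₁) (w₁≢w₂ ∘ sym) yw₂ w₂z₂ (adj-sym yw₁)
            z₁≢w₂ : z₁ ≢ w₂
            z₁≢w₂ refl = triangle-free (adj⇒≢ yw₁) (y≢H Hz₁) (adj⇒≢ w₁z₁) yw₁ w₁z₁ (adj-sym yw₂)

      open LargestExtension (largestExtension H D D⊆H D-independent)
        renaming (set to M; ⊆S to M⊆H; independent to M-independent; ⊇D to M⊇D)

      α₀≤∣M∣ : α₀ ≤ ∣ M ∣
      α₀≤∣M∣ = +-cancelʳ-≤ 1 α₀ ∣ M ∣ (subst₂ _≤_ (cong (λ b → α₀ + 𝟙 b) I′∋x) (+-comm 1 ∣ M ∣)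
                 (lift-bound I′ I′⊆support I′-independent M maximal))

      y≢x : y ≢ x
      y≢x = adj⇒≢ (adj-sym xy)

      y∉U : inU G y ≡ false
      y∉U = ≢true⇒false λ Uy →
        let l , xl , ll = support⇒leaf support-x
            y≢l : y ≢ l
            y≢l y≡l = true≢false y-type0 (subst (λ z → hasType G 0 z ≡ false) (sym y≡l) (leaf⇒untyped 0 ll))
        in triangle-free y≢x y≢l (adj⇒≢ xl) (adj-sym xy) xl (adj-sym (inU-adj₂ Uy (adj-sym xy) xl y≢l))

      -- The type-0 vertex w has a second neighbour z outside U; z is of type 0, lies in D ⊆ M, and w ~ z.
      module SecondNeighbour {w} (Mw : M ! w ≡ true) (yw : Adj G y w) where

        Hw : H ! w ≡ true
        Hw = M⊆H w Mw

        w0 : hasType G 0 w ≡ true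
        w0 = proj₁ (G₀-N⁻ I′ Hw)

        I′↛w : inNbhB G I′ w ≡ false
        I′↛w = proj₂ (G₀-N⁻ I′ Hw)

        w≢x : w ≢ x
        w≢x = differentTypes⇒≢ w0 x-type2 λ ()

        w-¬adj-x : ¬ Adj G w x
        w-¬adj-x wx = triangle-free (adj⇒≢ (adj-sym yw)) w≢x y≢x (adj-sym yw) (adj-sym xy) (adj-sym wx)

        w∉U : inU G w ≡ false
        w∉U = ≢true⇒false λ Uw → w-¬adj-x (inU-adj₂ Uw (adj-sym yw) (adj-sym xy) w≢x)

        second : Σ (Vtx G) λ z → z ≢ y × Adj G w z × inU G z ≡ false
        second = internal⇒anotherNeighbour (¬leaf⇒internal (typed⇒¬leaf w0) w∉U) (adj-sym yw) y∉U

        z : Vtx G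
        z = proj₁ second

        z≢y : z ≢ y
        z≢y = proj₁ (proj₂ second)

        wz : Adj G w z
        wz = proj₁ (proj₂ (proj₂ second))

        z0 : hasType G 0 z ≡ true
        z0 = byClass (classify z)
          where
          byClass : Class z → hasType G 0 z ≡ true
          byClass (is-leaf lz)  = ⊥-elim (true≢false lz (type0-¬adj-leaf w0 wz))
          byClass (is-type0 t0) = t0
          byClass (is-type1 t1) = ⊥-elim (true≢false (inNbhB-true I′ (I′-via t1 w0 yw wz) (adj-sym wz)) I′↛w)
          byClass (is-x z≡x)    = ⊥-elim (w-¬adj-x (subst (Adj G w) z≡x wz))

        ¬I′-adj-z : ∀ {u} → u ≡ x ⊎ (hasType G 1 u ≡ true × NearY u) → I′ ! u ≡ true → ¬ Adj G u z
        ¬I′-adj-z (inj₁ u≡x) _ uz =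
          square-free (adj⇒≢ xy) (w≢x ∘ sym) (differentTypes⇒≢ x-type2 z0 λ ()) (adj⇒≢ yw) (z≢y ∘ sym) (adj⇒≢ wz)
                      xy yw wz (adj-sym (subst (λ a → Adj G a z) u≡x uz))
        ¬I′-adj-z (inj₂ (t1 , adjacent yu)) _ uz =
          square-free (adj⇒≢ yw) (z≢y ∘ sym) (adj⇒≢ yu) (adj⇒≢ wz)
                      (differentTypes⇒≢ w0 t1 λ ()) (differentTypes⇒≢ z0 t1 λ ())
                      yw wz (adj-sym uz) (adj-sym yu)
        ¬I′-adj-z (inj₂ (t1 , viaType0 {w′} w′0 yw′ w′u)) I′u uz = byEq (w Finₚ.≟ w′)
          where
          byEq : Dec (w ≡ w′) → ⊥
          byEq (yes refl) = true≢false (inNbhB-true I′ I′u (adj-sym w′u)) I′↛w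
          byEq (no w≢w′) =
            pentagon-free (adj⇒≢ yw) (z≢y ∘ sym) (differentTypes⇒≢ y-type0 t1 λ ()) (adj⇒≢ yw′)
                          (adj⇒≢ wz) (differentTypes⇒≢ w0 t1 λ ()) w≢w′
                          (differentTypes⇒≢ z0 t1 λ ()) z≢w′ (differentTypes⇒≢ t1 w′0 λ ())
                          yw wz (adj-sym uz) (adj-sym w′u) (adj-sym yw′)
            where
            z≢w′ : z ≢ w′
            z≢w′ refl = triangle-free (adj⇒≢ yw) (z≢y ∘ sym) (adj⇒≢ wz) yw wz (adj-sym yw′)

        Mz : M ! z ≡ true
        Mz = M⊇D z (D⁺ Hz Hw yw wz)
          where
          Hz : H ! z ≡ true
          Hz = G₀-N⁺ I′ z0 (inNbhB-false I′ z λ u I′u → ≢true⇒false (¬I′-adj-z (I′⁻ I′u) I′u))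

      M-¬adj-y : ∀ {w} → M ! w ≡ true → ¬ Adj G y w
      M-¬adj-y {w} Mw yw = true≢false wz (M-independent w z Mw Mz)
        where open SecondNeighbour Mw yw

      contradiction : ⊥
      contradiction =
        <⇒≱ (∣S∣<∣S∪⁅v⁆∣ M M∌y) (≤-trans (≤-αOn V₀ (M ∪ ⁅ y ⁆) M′⊆V₀ M′-independent) α₀≤∣M∣)
        where
        M∌y : M ! y ≡ false
        M∌y = ≢true⇒false λ My → true≢false (M⊆H y My) H∌y
        M′⊆V₀ : (M ∪ ⁅ y ⁆) ⊆ V₀
        M′⊆V₀ v p = [ (λ Mv → G₀-N⊆V₀ I′ v (M⊆H v Mv))
                    , (λ v≡y → trans (lookup∘tabulate (hasType G 0) v)
                                     (subst (λ z → hasType G 0 z ≡ true) (sym v≡y) y-type0)) ]′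
                    (lookup-∪⁅⁆⁻ M p)
        M′-independent : Independent (M ∪ ⁅ y ⁆)
        M′-independent a b pa pb = ≢true⇒false (byCases (lookup-∪⁅⁆⁻ M pa) (lookup-∪⁅⁆⁻ M pb))
          where
          byCases : M ! a ≡ true ⊎ a ≡ y → M ! b ≡ true ⊎ b ≡ y → ¬ Adj G a b
          byCases (inj₁ Ma)  (inj₁ Mb)  ab = true≢false ab (M-independent a b Ma Mb)
          byCases (inj₁ Ma)  (inj₂ b≡y) ab = M-¬adj-y Ma (adj-sym (subst (Adj G a) b≡y ab))
          byCases (inj₂ a≡y) (inj₁ Mb)  ab = M-¬adj-y Mb (subst (λ c → Adj G c b) a≡y ab)
          byCases (inj₂ a≡y) (inj₂ b≡y) ab = adj⇒≢ ab (trans a≡y (sym b≡y))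

    x-¬adj-type0 : ∀ v → Adj G x v → hasType G 0 v ≡ false
    x-¬adj-type0 v xv = ≢true⇒false (Type0NeighbourOfX.contradiction v xv)

    α₀≡iOn-G₀-N : ∀ I → (∀ v → I ! v ≡ true → hasType G 1 v ≡ true) → Independent I →
      (∀ v → I ! v ≡ true → adj G x v ≡ false) → α₀ ≡ iOn G (G₀-N I)
    α₀≡iOn-G₀-N I I⊆V₁ indI x↛I = ≤-antisym lower (iOn-G₀-N-≤ I)
      where
      open WithX I
      lower : α₀ ≤ iOn G (G₀-N I)
      lower = +-cancelʳ-≤ 1 α₀ (iOn G (G₀-N I))
        (subst₂ _≤_ (cong (λ b → α₀ + 𝟙 b) J∋x) (trans (cong (suc ∘ iOn G) (G₀-N-J x-¬adj-type0)) (+-comm 1 _))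
          (lift-bound-iOn J (J⊆support (λ v Iv → type1⇒support (I⊆V₁ v Iv))) (J-independent indI x↛I)))

    α₀≤suc-iOn-G₀-N : ∀ I → (∀ v → I ! v ≡ true → hasType G 1 v ≡ true) → Independent I →
      α₀ ≤ suc (iOn G (G₀-N I))
    α₀≤suc-iOn-G₀-N I I⊆V₁ indI =
      ≤-trans (m≤m+n α₀ _) (lift-bound-iOn I (λ v Iv → type1⇒support (I⊆V₁ v Iv)) indI)

    wellCovered : WellCoveredOn G V₀
    wellCovered = trans (α₀≡iOn-G₀-N ∅ (λ v ∅v → ⊥-elim (true≢false ∅v (lookup-∅ v))) ∅-independent
                                     (λ v ∅v → ⊥-elim (true≢false ∅v (lookup-∅ v))))
                        (cong (iOn G) G₀-N-∅)

  indepInV₁⁻ : ∀ I → indepInB G (V G 1) I ≡ true → (∀ v → I ! v ≡ true → hasType G 1 v ≡ true) × Independent I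
  indepInV₁⁻ I p = let I⊆V₁ , indI = indepInB⁻ (V G 1) I p
                   in (λ v Iv → trans (sym (lookup∘tabulate (hasType G 1) v)) (I⊆V₁ v Iv)) , indI

  Conditions : Set
  Conditions = (∀ v → v ≢ x → internal G v ≡ true → hasType G 0 v ≡ true ⊎ hasType G 1 v ≡ true)
             × (∀ v → Adj G x v → hasType G 0 v ≡ false)
             × WellCoveredOn G V₀
             × (∀ I → indepInB G (V G 1) I ≡ true
                 → ((∀ v → I ! v ≡ true → adj G x v ≡ false) → α₀ ≡ iOn G (G₀-N I))
                 × ((Σ (Vtx G) λ v → I ! v ≡ true × Adj G x v) → α₀ ≤ suc (iOn G (G₀-N I))))

  necessary : AlmostWellCovered G → Conditions
  necessary awc = internal-type , x-¬adj-type0 , wellCovered , onV₁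
    where
    open Forward awc
    onV₁ : ∀ I → indepInB G (V G 1) I ≡ true
         → ((∀ v → I ! v ≡ true → adj G x v ≡ false) → α₀ ≡ iOn G (G₀-N I))
         × ((Σ (Vtx G) λ v → I ! v ≡ true × Adj G x v) → α₀ ≤ suc (iOn G (G₀-N I)))
    onV₁ I p = α₀≡iOn-G₀-N I (proj₁ (indepInV₁⁻ I p)) (proj₂ (indepInV₁⁻ I p))
             , λ _ → α₀≤suc-iOn-G₀-N I (proj₁ (indepInV₁⁻ I p)) (proj₂ (indepInV₁⁻ I p))

  module Backward (x↛V₀ : ∀ v → Adj G x v → hasType G 0 v ≡ false) (wc : WellCoveredOn G V₀)
    (onV₁ : ∀ I → indepInB G (V G 1) I ≡ true
          → ((∀ v → I ! v ≡ true → adj G x v ≡ false) → α₀ ≡ iOn G (G₀-N I))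
          × ((Σ (Vtx G) λ v → I ! v ≡ true × Adj G x v) → α₀ ≤ suc (iOn G (G₀-N I)))) where

    suc-i≤α : suc (iOn G (allV G)) ≤ αOn G (allV G)
    suc-i≤α = begin
      suc (iOn G (allV G))     ≤⟨ s≤s (iOn-≤ (allV G) L.S L.maximal) ⟩
      suc ∣ L.S ∣              ≡⟨ trans (cong (λ b → ∣ L.S ∣ + 𝟙 b) J∋x) (+-comm ∣ L.S ∣ 1) ⟨
      ∣ L.S ∣ + 𝟙 (J ! x)      ≡⟨ L.size ⟩
      ∣ T ∣ + leafTotal        ≡⟨ cong (_+ leafTotal) ∣T∣≡α₀ ⟩
      α₀ + leafTotal           ≡⟨ α-decomposition ⟨
      αOn G (allV G)           ∎
      where
      open ≤-Reasoning
      open WithX ∅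
      T = proj₁ (iOn-attained (G₀-N J))
      maxT = proj₁ (proj₂ (iOn-attained (G₀-N J)))
      ∣T∣≡α₀ : ∣ T ∣ ≡ α₀
      ∣T∣≡α₀ = trans (proj₂ (proj₂ (iOn-attained (G₀-N J))))
                     (trans (cong (iOn G) (trans (G₀-N-J x↛V₀) G₀-N-∅)) (sym wc))
      module L = Lift J (J⊆support (λ v ∅v → ⊥-elim (true≢false ∅v (lookup-∅ v))))
                        (J-independent ∅-independent (λ v ∅v → ⊥-elim (true≢false ∅v (lookup-∅ v)))) T maxT

    module Trace (S : Subset (n G)) (maxS : maxIndepInB G (allV G) S ≡ true) where

      private
        indS = proj₁ (proj₂ (maxIndepInB⁻ (allV G) S maxS))
        domS = proj₂ (proj₂ (maxIndepInB⁻ (allV G) S maxS))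
        inI inT : Vtx G → Bool
        inI v = hasType G 1 v ∧ S ! v
        inT v = hasType G 0 v ∧ S ! v

      I T : Subset (n G)
      I = tabulate inI
      T = tabulate inT

      I⁻ : ∀ {v} → I ! v ≡ true → hasType G 1 v ≡ true × S ! v ≡ true
      I⁻ {v} p = let q = trans (sym (lookup∘tabulate inI v)) p in ∧-trueˡ q , ∧-trueʳ q

      T⁻ : ∀ {v} → T ! v ≡ true → hasType G 0 v ≡ true × S ! v ≡ true
      T⁻ {v} p = let q = trans (sym (lookup∘tabulate inT v)) p in ∧-trueˡ q , ∧-trueʳ q

      ∣T∣≡type0Part : ∣ T ∣ ≡ type0Part S
      ∣T∣≡type0Part = ∣tabulate∣≡count inT

      I-independentInV₁ : indepInB G (V G 1) I ≡ true
      I-independentInV₁ = indepInB⁺ (V G 1) I (λ v Iv → trans (lookup∘tabulate (hasType G 1) v) (proj₁ (I⁻ Iv)))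
                                    (λ u v Iu Iv → indS u v (proj₂ (I⁻ Iu)) (proj₂ (I⁻ Iv)))

      T-maximal : maxIndepInB G (G₀-N I) T ≡ true
      T-maximal = maxIndepInB⁺ (G₀-N I) T T⊆ indT domT
        where
        T⊆ : T ⊆ G₀-N I
        T⊆ v Tv = G₀-N⁺ I (proj₁ (T⁻ Tv)) (inNbhB-false I v λ u Iu → indS u v (proj₂ (I⁻ Iu)) (proj₂ (T⁻ Tv)))
        indT : Independent T
        indT u v Tu Tv = indS u v (proj₂ (T⁻ Tu)) (proj₂ (T⁻ Tv))
        domT : Dominates T (G₀-N I)
        domT v Hv T∌v = byClass (classify u)
          where
          v0 = proj₁ (G₀-N⁻ I Hv)
          I↛v = proj₂ (G₀-N⁻ I Hv)
          S∌v : S ! v ≡ false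
          S∌v = ≢true⇒false λ Sv → true≢false (trans (lookup∘tabulate inT v) (∧-true v0 Sv)) T∌v
          dominator = domS v (lookup-allV v) S∌v
          u = proj₁ dominator
          Su = proj₁ (proj₂ dominator)
          uv = proj₂ (proj₂ dominator)
          byClass : Class u → Σ (Vtx G) λ u → T ! u ≡ true × Adj G u v
          byClass (is-leaf lu)  = ⊥-elim (true≢false lu (type0-¬adj-leaf v0 (adj-sym uv)))
          byClass (is-type0 u0) = u , trans (lookup∘tabulate inT u) (∧-true u0 Su) , uv
          byClass (is-type1 u1) = ⊥-elim (true≢false (inNbhB-true I (trans (lookup∘tabulate inI u) (∧-true u1 Su)) uv) I↛v)
          byClass (is-x u≡x)    = ⊥-elim (true≢false v0 (x↛V₀ v (subst (λ z → Adj G z v) u≡x uv)))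

      α₀+𝟙x≤suc∣T∣ : α₀ + 𝟙 (S ! x) ≤ suc ∣ T ∣
      α₀+𝟙x≤suc∣T∣ = [ inS , notInS ]′ (true-or-false (S ! x))
        where
        i≤∣T∣ : iOn G (G₀-N I) ≤ ∣ T ∣
        i≤∣T∣ = iOn-≤ (G₀-N I) T T-maximal
        onV₁-free = proj₁ (onV₁ I I-independentInV₁)
        onV₁-adjacent = proj₂ (onV₁ I I-independentInV₁)
        inS : S ! x ≡ true → α₀ + 𝟙 (S ! x) ≤ suc ∣ T ∣
        inS Sx = subst (λ b → α₀ + 𝟙 b ≤ suc ∣ T ∣) (sym Sx) (subst (_≤ suc ∣ T ∣) (+-comm 1 α₀)
                   (s≤s (≤-trans (≤-reflexive (onV₁-free λ v Iv → indS x v Sx (proj₂ (I⁻ Iv)))) i≤∣T∣)))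
        α₀≤suc-i : α₀ ≤ suc (iOn G (G₀-N I))
        α₀≤suc-i = [ (λ I→x → let u , Iu , ux = inNbhB-true⁻ I x I→x in onV₁-adjacent (u , Iu , adj-sym ux))
                   , (λ I↛x → ≤-trans (≤-reflexive (onV₁-free λ v Iv → ≢true⇒false λ xv →
                                          true≢false (inNbhB-true I Iv (adj-sym xv)) I↛x))
                                      (n≤1+n _)) ]′
                   (true-or-false (inNbhB G I x))
        notInS : S ! x ≡ false → α₀ + 𝟙 (S ! x) ≤ suc ∣ T ∣
        notInS S∌x = subst (λ b → α₀ + 𝟙 b ≤ suc ∣ T ∣) (sym S∌x)
                       (subst (_≤ suc ∣ T ∣) (sym (+-identityʳ α₀)) (≤-trans α₀≤suc-i (s≤s i≤∣T∣)))

    α≤suc-i : αOn G (allV G) ≤ suc (iOn G (allV G))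
    α≤suc-i = +-cancelʳ-≤ k (αOn G (allV G)) (suc (iOn G (allV G))) (begin
      αOn G (allV G) + k            ≡⟨ cong (_+ k) α-decomposition ⟩
      α₀ + leafTotal + k            ≡⟨ xy∙z≈xz∙y α₀ leafTotal k ⟩
      α₀ + k + leafTotal            ≤⟨ +-monoˡ-≤ leafTotal α₀+𝟙x≤suc∣T∣ ⟩
      suc ∣ T ∣ + leafTotal         ≡⟨ cong (λ t → suc t + leafTotal) ∣T∣≡type0Part ⟩
      suc (type0Part S + leafTotal) ≡⟨ cong suc (maximal-size S indS domS) ⟨
      suc (∣ S ∣ + k)               ≡⟨ cong (λ s → suc (s + k)) ∣S∣≡i ⟩
      suc (iOn G (allV G)) + k      ∎)
      where
      open ≤-Reasoning
      S = proj₁ (iOn-attained (allV G))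
      maxS = proj₁ (proj₂ (iOn-attained (allV G)))
      ∣S∣≡i = proj₂ (proj₂ (iOn-attained (allV G)))
      indS = proj₁ (proj₂ (maxIndepInB⁻ (allV G) S maxS))
      domS = proj₂ (proj₂ (maxIndepInB⁻ (allV G) S maxS))
      k = 𝟙 (S ! x)
      open Trace S maxS

    almostWellCovered : AlmostWellCovered G
    almostWellCovered = ≤-antisym α≤suc-i suc-i≤α

  sufficient : Conditions → AlmostWellCovered G
  sufficient (_ , x↛V₀ , wc , onV₁) = Backward.almostWellCovered x↛V₀ wc onV₁

theorem3p5 : (G : Graph) → GirthAtLeast6 G → (x : Vtx G)
    → hasType G 2 x ≡ true
    → (∀ v → hasType G 2 v ≡ true → v ≡ x)
    → (∀ k v → 3 ≤ k → hasType G k v ≡ false)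
    → AlmostWellCovered G ⇔
      ( (∀ v → v ≢ x → internal G v ≡ true → (hasType G 0 v ≡ true ⊎ hasType G 1 v ≡ true))
      × (∀ v → adj G x v ≡ true → hasType G 0 v ≡ false)
      × WellCoveredOn G (V G 0)
      × (∀ (I : Subset (n G)) → indepInB G (V G 1) I ≡ true
          → ((∀ v → mem G I v ≡ true → adj G x v ≡ false)
               → αOn G (V G 0) ≡ iOn G (minusNbh G (V G 0) I))
          × ((Σ (Vtx G) λ v → mem G I v ≡ true × adj G x v ≡ true)
               → αOn G (V G 0) ≤ suc (iOn G (minusNbh G (V G 0) I)))) )
theorem3p5 G girth x x-type2 type2⇒x no-type≥3 = mk⇔ necessary sufficient
  where open UniqueType2 G girth x x-type2 type2⇒x no-type≥3
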